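{- There is an absolute constant $c>0$ such that for any integer $n\ge32$ and any $\rho\in[1/n,1/32]$, there is a weighted graph $G$ on $n+1$ vertices such that every spanner $H$ of $G$ with lightness at most $1+\rho$ has average distortion at least $c/\rho$.
   Context: A spanner of a weighted graph $G=(V,E,w)$ is a subgraph $H=(V,E')$, $E'\subseteq E$, with the induced weights; its lightness is $w(H)/w(T)$ where $T$ is a minimum spanning tree of $G$. The average distortion of $H$ is $\binom{|V|}{2}^{ -1}\sum_{\{u,v\}\in\binom{V}{2}} d_H(u,v)/d_G(u,v)$, with $d$ the shortest-path distance.
   Formalization: The parameter ρ ranges only over the rationals in $[1/n,1/32]$, and the constant c and the edge weights of G are taken in the rationals. -}

module Defs where

open import Data.Nat using (ℕ; zero; suc; _∸_)
open import Data.Bool using (Bool; true; false; if_then_else_; _∧_)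
open import Data.Fin using (Fin; toℕ)
open import Data.List using (List; []; _∷_; foldr; map; allFin; length; filter)
open import Data.Integer using (+_)
open import Data.Rational using (ℚ; 0ℚ; 1ℚ; _+_; _*_; _<_; _≤_; _÷_; ≢-nonZero; _/_)
open import Data.Rational.Properties using (_≟_)
open import Relation.Binary.PropositionalEquality using (_≡_)
open import Relation.Nullary using (yes; no)
open import Data.Nat.Properties using () renaming (_<?_ to _<ℕ?_)
open import Relation.Nullary.Decidable using (⌊_⌋)
open import Data.Product using (Σ; _×_; ∃)

record WGraph (m : ℕ) : Set where
  field
    adj     : Fin m → Fin m → Bool
    w       : Fin m → Fin m → ℚ
    adj-sym : ∀ i j → adj i j ≡ adj j i
    w-sym   : ∀ i j → w i j ≡ w j i
    irrefl  : ∀ i → adj i i ≡ false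
    w-pos   : ∀ i j → adj i j ≡ true → 0ℚ < w i j
open WGraph public

-- A subgraph (on the same vertex set) is given by a sub-edge-set;
-- weights are the induced ones.
record Subgraph {m : ℕ} (G : WGraph m) : Set where
  field
    sadj    : Fin m → Fin m → Bool
    sadj-sym : ∀ i j → sadj i j ≡ sadj j i
    sadj-⊆  : ∀ i j → sadj i j ≡ true → adj G i j ≡ true
open Subgraph public

sumℚ : List ℚ → ℚ
sumℚ = foldr _+_ 0ℚ

pairs : (m : ℕ) → List (Fin m × Fin m)
pairs m = Data.List.concatMap (λ i → map (λ j → (i Data.Product., j))
            (filter (λ j → toℕ i <ℕ? toℕ j) (allFin m))) (allFin m)
  where import Data.List
        import Data.Product

edgeCount : {m : ℕ} → (Fin m → Fin m → Bool) → ℕ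
edgeCount {m} e = length (filter (λ p → Data.Bool.Properties.T? (e (Data.Product.proj₁ p) (Data.Product.proj₂ p))) (pairs m))
  where import Data.Bool.Properties
        import Data.Product

weightOf : {m : ℕ} → WGraph m → (Fin m → Fin m → Bool) → ℚ
weightOf {m} G e = sumℚ (map (λ p → if e (Data.Product.proj₁ p) (Data.Product.proj₂ p)
                                     then w G (Data.Product.proj₁ p) (Data.Product.proj₂ p) else 0ℚ) (pairs m))
  where import Data.Product

wH : {m : ℕ} {G : WGraph m} → Subgraph G → ℚ
wH {G = G} H = weightOf G (sadj H)

-- Extended rationals (∞ = no path) and shortest-path distances.

data ℚ∞ : Set where
  fin : ℚ → ℚ∞
  ∞   : ℚ∞

_+∞_ : ℚ∞ → ℚ∞ → ℚ∞
fin p +∞ fin q = fin (p + q)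
_ +∞ _ = ∞

min∞ : ℚ∞ → ℚ∞ → ℚ∞
min∞ ∞ y = y
min∞ x ∞ = x
min∞ (fin p) (fin q) with p Data.Rational.≤? q
  where import Data.Rational
... | yes _ = fin p
... | no  _ = fin q

minList∞ : List ℚ∞ → ℚ∞
minList∞ = foldr min∞ ∞

-- dist≤ e w k u v = minimum weight of a walk from u to v with at most
-- k edges, all in edge set e (∞ if there is none).
dist≤ : {m : ℕ} → (Fin m → Fin m → Bool) → (Fin m → Fin m → ℚ) → ℕ → Fin m → Fin m → ℚ∞
dist≤ {m} e wt zero u v with toℕ u Data.Nat.≟ toℕ v
  where import Data.Nat
... | yes _ = fin 0ℚ
... | no  _ = ∞
dist≤ {m} e wt (suc k) u v =
  min∞ (dist≤ e wt k u v)
       (minList∞ (map (λ x → if e x v then dist≤ e wt k u x +∞ fin (wt x v) else ∞) (allFin m)))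

-- Shortest-path distance: minimum over walks with at most m edges
-- (every shortest path is simple, hence has < m edges).
distE : {m : ℕ} → (Fin m → Fin m → Bool) → (Fin m → Fin m → ℚ) → Fin m → Fin m → ℚ∞
distE {m} e wt = dist≤ e wt m

dG : {m : ℕ} → WGraph m → Fin m → Fin m → ℚ∞
dG G = distE (adj G) (w G)

dH : {m : ℕ} {G : WGraph m} → Subgraph G → Fin m → Fin m → ℚ∞
dH {G = G} H = distE (sadj H) (w G)

Connected : {m : ℕ} → (Fin m → Fin m → Bool) → Set
Connected {m} e = ∀ u v → Σ ℚ λ q → distE e (λ (_ _ : Fin m) → 1ℚ) u v ≡ fin q

IsSpanningTree : {m : ℕ} {G : WGraph m} → Subgraph G → Set
IsSpanningTree {m} T = Connected (sadj T) × edgeCount (sadj T) ≡ m ∸ 1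

IsMST : {m : ℕ} {G : WGraph m} → Subgraph G → Set
IsMST {G = G} T = IsSpanningTree T × ((T' : Subgraph G) → IsSpanningTree T' → wH T ≤ wH T')

-- ratio d_H(u,v) / d_G(u,v)   (d_G(u,v) > 0 for u ≠ v; the 0 branch is
-- never used for connected G with positive weights).
ratio∞ : ℚ∞ → ℚ∞ → ℚ∞
ratio∞ ∞ _ = ∞
ratio∞ (fin a) ∞ = fin 0ℚ
ratio∞ (fin a) (fin b) with b ≟ 0ℚ
... | yes _ = fin 0ℚ
... | no b≢0 = fin (_÷_ a b {{≢-nonZero b≢0}})

sum∞ : List ℚ∞ → ℚ∞
sum∞ = foldr _+∞_ (fin 0ℚ)

choose2 : ℕ → ℕ
choose2 zero = zero
choose2 (suc k) = k Data.Nat.+ choose2 k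
  where import Data.Nat

avgDistortion : {m : ℕ} {G : WGraph m} → Subgraph G → ℚ∞
avgDistortion {m} {G} H with sum∞ (map (λ p → ratio∞ (dH H (Data.Product.proj₁ p) (Data.Product.proj₂ p))
                                                      (dG G (Data.Product.proj₁ p) (Data.Product.proj₂ p))) (pairs m))
  where import Data.Product
... | ∞ = ∞
... | fin s with choose2 m
...   | zero = fin 0ℚ
...   | suc k = fin (s * (+ 1 / suc k))

_≥∞_ : ℚ∞ → ℚ → Set
∞ ≥∞ _ = Data.Unit.⊤
  where import Data.Unit
fin x ≥∞ y = y ≤ x

-- x ≥ c / ρ  for ρ > 0, stated without division:  c ≤ ρ * x  (and ∞ ≥ anything).
_≥∞_÷_ : ℚ∞ → ℚ → ℚ → Set
∞ ≥∞ c ÷ ρ = Data.Unit.⊤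
  where import Data.Unit
fin x ≥∞ c ÷ ρ = c ≤ ρ * x

module Submission where

-- Construction (n = n' + 1 path vertices, hub weight A = 4ρn): a hub joined to
-- every vertex of a path of unit-weight edges by an edge of weight A.  Its MST
-- is the path plus one hub edge, of weight A + n'.  Let H have lightness at
-- most 1 + ρ and finite average distortion (otherwise there is nothing to do).
--  1. Every path vertex is reachable from the hub in H, so each maximal
--     segment of kept path edges carries a hub edge (a segment without one
--     would be cut off); counting segments, #path + #hub ≥ n.
--  2. Two hub edges would already make H too heavy, so H keeps exactly one.
--  3. Then "position along the path" is a potential for H: d_H(i, j) ≥ j - i,
--     while d_G(i, j) ≤ 2A through the hub.  Summing over pairs gives
--     average distortion ≥ (Σ_{i<j} (j - i)) / (2A · C(n+1,2)) ≥ 1/(32ρ).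

module NatEmbedding where
  open import Data.Nat as ℕ using (ℕ; suc)
  import Data.Nat.Properties as ℕP
  open import Data.Integer as ℤ using (+_)
  import Data.Integer.Properties as ℤP
  open import Data.Integer.Tactic.RingSolver using (solve-∀)
  open import Data.Rational using (ℚ; 0ℚ; 1ℚ; _+_; _*_; _-_; _≤_; _<_; _/_; toℚᵘ)
  open import Data.Rational.Properties
  import Data.Rational.Unnormalised as U
  import Data.Rational.Unnormalised.Properties as UP
  import Data.Rational.Solver as QS
  open import Relation.Binary.PropositionalEquality

  ⌜_⌝ : ℕ → ℚ
  ⌜ n ⌝ = + n / 1

  toℚᵘ-⌜⌝ : ∀ n → toℚᵘ ⌜ n ⌝ U.≃ U.mkℚᵘ (+ n) 0
  toℚᵘ-⌜⌝ n = toℚᵘ-fromℚᵘ (U.mkℚᵘ (+ n) 0)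

  ⌜⌝-+ : ∀ a b → ⌜ a ℕ.+ b ⌝ ≡ ⌜ a ⌝ + ⌜ b ⌝
  ⌜⌝-+ a b = toℚᵘ-injective (begin
    toℚᵘ ⌜ a ℕ.+ b ⌝                   ≈⟨ toℚᵘ-⌜⌝ (a ℕ.+ b) ⟩
    U.mkℚᵘ (+ (a ℕ.+ b)) 0             ≈⟨ U.*≡* (trans (cong (ℤ._* (+ 1 ℤ.* + 1)) (ℤP.pos-+ a b))
                                                        (cross-multiply (+ a) (+ b))) ⟩
    U.mkℚᵘ (+ a) 0 U.+ U.mkℚᵘ (+ b) 0   ≈⟨ UP.+-cong (toℚᵘ-⌜⌝ a) (toℚᵘ-⌜⌝ b) ⟨
    toℚᵘ ⌜ a ⌝ U.+ toℚᵘ ⌜ b ⌝           ≈⟨ toℚᵘ-homo-+ ⌜ a ⌝ ⌜ b ⌝ ⟨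
    toℚᵘ (⌜ a ⌝ + ⌜ b ⌝)                ∎)
    where
    open UP.≃-Reasoning
    cross-multiply : ∀ (x y : ℤ.ℤ) → (x ℤ.+ y) ℤ.* (+ 1 ℤ.* + 1) ≡ (x ℤ.* + 1 ℤ.+ y ℤ.* + 1) ℤ.* + 1
    cross-multiply = solve-∀

  ⌜⌝-* : ∀ a b → ⌜ a ℕ.* b ⌝ ≡ ⌜ a ⌝ * ⌜ b ⌝
  ⌜⌝-* a b = toℚᵘ-injective (begin
    toℚᵘ ⌜ a ℕ.* b ⌝                   ≈⟨ toℚᵘ-⌜⌝ (a ℕ.* b) ⟩
    U.mkℚᵘ (+ (a ℕ.* b)) 0             ≈⟨ U.*≡* (trans (cong (ℤ._* (+ 1 ℤ.* + 1)) (ℤP.pos-* a b))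
                                                        (cross-multiply (+ a) (+ b))) ⟩
    U.mkℚᵘ (+ a) 0 U.* U.mkℚᵘ (+ b) 0   ≈⟨ UP.*-cong (toℚᵘ-⌜⌝ a) (toℚᵘ-⌜⌝ b) ⟨
    toℚᵘ ⌜ a ⌝ U.* toℚᵘ ⌜ b ⌝           ≈⟨ toℚᵘ-homo-* ⌜ a ⌝ ⌜ b ⌝ ⟨
    toℚᵘ (⌜ a ⌝ * ⌜ b ⌝)                ∎)
    where
    open UP.≃-Reasoning
    cross-multiply : ∀ (x y : ℤ.ℤ) → (x ℤ.* y) ℤ.* (+ 1 ℤ.* + 1) ≡ (x ℤ.* y) ℤ.* + 1
    cross-multiply = solve-∀

  ⌜⌝-suc : ∀ a → ⌜ suc a ⌝ ≡ ⌜ a ⌝ + 1ℚ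
  ⌜⌝-suc a = trans (⌜⌝-+ 1 a) (+-comm 1ℚ ⌜ a ⌝)

  ⌜⌝-nonneg : ∀ n → 0ℚ ≤ ⌜ n ⌝
  ⌜⌝-nonneg n = nonNegative⁻¹ ⌜ n ⌝ {{normalize-nonNeg n 1}}

  ⌜⌝-mono : ∀ {a b} → a ℕ.≤ b → ⌜ a ⌝ ≤ ⌜ b ⌝
  ⌜⌝-mono {a} {b} a≤b = begin
    ⌜ a ⌝                   ≡⟨ +-identityʳ ⌜ a ⌝ ⟨
    ⌜ a ⌝ + 0ℚ              ≤⟨ +-monoʳ-≤ ⌜ a ⌝ (⌜⌝-nonneg (b ℕ.∸ a)) ⟩
    ⌜ a ⌝ + ⌜ b ℕ.∸ a ⌝      ≡⟨ ⌜⌝-+ a (b ℕ.∸ a) ⟨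
    ⌜ a ℕ.+ (b ℕ.∸ a) ⌝      ≡⟨ cong ⌜_⌝ (ℕP.m+[n∸m]≡n a≤b) ⟩
    ⌜ b ⌝                   ∎
    where open ≤-Reasoning

  ⌜⌝-pos : ∀ n → 0ℚ < ⌜ suc n ⌝
  ⌜⌝-pos n = <-≤-trans (positive⁻¹ 1ℚ) (⌜⌝-mono {1} {suc n} (ℕ.s≤s ℕ.z≤n))

  ⌜⌝-∸ : ∀ {a b} → a ℕ.≤ b → ⌜ b ⌝ - ⌜ a ⌝ ≡ ⌜ b ℕ.∸ a ⌝
  ⌜⌝-∸ {a} {b} a≤b = begin
    ⌜ b ⌝ - ⌜ a ⌝                    ≡⟨ cong (λ z → ⌜ z ⌝ - ⌜ a ⌝) (ℕP.m+[n∸m]≡n a≤b) ⟨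
    ⌜ a ℕ.+ (b ℕ.∸ a) ⌝ - ⌜ a ⌝       ≡⟨ cong (_- ⌜ a ⌝) (⌜⌝-+ a (b ℕ.∸ a)) ⟩
    (⌜ a ⌝ + ⌜ b ℕ.∸ a ⌝) - ⌜ a ⌝     ≡⟨ cancel ⌜ a ⌝ ⌜ b ℕ.∸ a ⌝ ⟩
    ⌜ b ℕ.∸ a ⌝                      ∎
    where
    open ≡-Reasoning
    open QS.+-*-Solver
    cancel : ∀ x y → (x + y) - x ≡ y
    cancel = solve 2 (λ x y → (x :+ y) :- x := y) refl

  ⌜⌝-inverse : ∀ K → (+ 1 / suc K) * ⌜ suc K ⌝ ≡ 1ℚ
  ⌜⌝-inverse K = toℚᵘ-injective (begin
    toℚᵘ ((+ 1 / suc K) * ⌜ suc K ⌝)             ≈⟨ toℚᵘ-homo-* (+ 1 / suc K) ⌜ suc K ⌝ ⟩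
    toℚᵘ (+ 1 / suc K) U.* toℚᵘ ⌜ suc K ⌝         ≈⟨ UP.*-cong (toℚᵘ-fromℚᵘ (U.mkℚᵘ (+ 1) K)) (toℚᵘ-⌜⌝ (suc K)) ⟩
    U.mkℚᵘ (+ 1) K U.* U.mkℚᵘ (+ suc K) 0         ≈⟨ U.*≡* (cross-multiply (+ suc K)) ⟩
    U.1ℚᵘ                                        ∎)
    where
    open UP.≃-Reasoning
    cross-multiply : ∀ (x : ℤ.ℤ) → (+ 1 ℤ.* x) ℤ.* + 1 ≡ + 1 ℤ.* (x ℤ.* + 1)
    cross-multiply = solve-∀

-- Finite sums, and how the list `pairs m` of unordered pairs {i < j}
-- decomposes: the pairs through vertex 0, then the shifted pairs of Fin m.
module Sums where
  open import Defs
  open import Data.Nat as ℕ using (ℕ; zero; suc; _≤_; z≤n; s≤s)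
  import Data.Nat.Properties as ℕP
  open import Data.Nat.ListAction using (sum)
  open import Data.Bool using (Bool; true; false; if_then_else_)
  import Data.Bool.Properties as BoolP
  open import Data.Fin using (Fin; toℕ; zero; suc)
  open import Data.List using (List; []; _∷_; map; filter; allFin; tabulate; concat; _++_; length)
  open import Data.List.Properties using (map-tabulate; map-∘; concat-map; tabulate-cong; map-++; filter-all)
  open import Data.List.Relation.Unary.All.Properties using (tabulate⁺)
  open import Data.Nat.ListAction.Properties using (sum-++)
  open import Data.Product using (_×_; _,_)
  open import Data.Rational using (ℚ; 0ℚ; 1ℚ; _+_; _*_)
  import Data.Rational.Properties as ℚP
  open import Relation.Binary.PropositionalEquality
  open import Relation.Nullary using (does)
  open import Relation.Unary using (Pred; Decidable)
  open import Function using (id)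
  open import Level using (0ℓ)
  open import Data.Nat.Properties using () renaming (_<?_ to _<ℕ?_)
  open NatEmbedding

  Σℕ : {A : Set} → (A → ℕ) → List A → ℕ
  Σℕ g xs = sum (map g xs)

  Σℚ : {A : Set} → (A → ℚ) → List A → ℚ
  Σℚ g xs = sumℚ (map g xs)

  Σℕ-++ : {A : Set} (g : A → ℕ) (xs ys : List A) → Σℕ g (xs ++ ys) ≡ Σℕ g xs ℕ.+ Σℕ g ys
  Σℕ-++ g xs ys = trans (cong sum (map-++ g xs ys)) (sum-++ (map g xs) (map g ys))

  Σℚ-++ : {A : Set} (g : A → ℚ) (xs ys : List A) → Σℚ g (xs ++ ys) ≡ Σℚ g xs + Σℚ g ys
  Σℚ-++ g [] ys = sym (ℚP.+-identityˡ _)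
  Σℚ-++ g (x ∷ xs) ys = trans (cong (g x +_) (Σℚ-++ g xs ys)) (sym (ℚP.+-assoc (g x) _ _))

  Σℕ-map : {A B : Set} (g : B → ℕ) (f : A → B) (xs : List A) → Σℕ g (map f xs) ≡ Σℕ (λ x → g (f x)) xs
  Σℕ-map g f xs = cong sum (sym (map-∘ xs))

  Σℚ-map : {A B : Set} (g : B → ℚ) (f : A → B) (xs : List A) → Σℚ g (map f xs) ≡ Σℚ (λ x → g (f x)) xs
  Σℚ-map g f xs = cong sumℚ (sym (map-∘ xs))

  Σℕ-zero : {A : Set} (xs : List A) → Σℕ (λ _ → 0) xs ≡ 0
  Σℕ-zero [] = refl
  Σℕ-zero (x ∷ xs) = Σℕ-zero xs

  Σℕ-allFin : ∀ m (g : Fin (suc m) → ℕ) → Σℕ g (allFin (suc m)) ≡ g zero ℕ.+ Σℕ (λ j → g (suc j)) (allFin m)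
  Σℕ-allFin m g = cong (g zero ℕ.+_) (trans (cong (Σℕ g) (sym (map-tabulate id suc))) (Σℕ-map g suc (allFin m)))

  𝟙 : Bool → ℕ
  𝟙 true = 1
  𝟙 false = 0

  𝟙≤1 : ∀ b → 𝟙 b ≤ 1
  𝟙≤1 true = s≤s z≤n
  𝟙≤1 false = z≤n

  length-filter : {A : Set} (b : A → Bool) (xs : List A) →
    length (filter (λ x → BoolP.T? (b x)) xs) ≡ Σℕ (λ x → 𝟙 (b x)) xs
  length-filter b [] = refl
  length-filter b (x ∷ xs) with b x
  ... | true = cong suc (length-filter b xs)
  ... | false = length-filter b xs

  Σℚ-if : {A : Set} (b : A → Bool) (c : ℚ) (xs : List A) →
    Σℚ (λ x → if b x then c else 0ℚ) xs ≡ c * ⌜ Σℕ (λ x → 𝟙 (b x)) xs ⌝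
  Σℚ-if b c [] = sym (ℚP.*-zeroʳ c)
  Σℚ-if b c (x ∷ xs) with b x
  ... | false = trans (ℚP.+-identityˡ _) (Σℚ-if b c xs)
  ... | true = begin
    c + Σℚ (λ x → if b x then c else 0ℚ) xs    ≡⟨ cong (c +_) (Σℚ-if b c xs) ⟩
    c + c * ⌜ N ⌝                              ≡⟨ cong (_+ c * ⌜ N ⌝) (ℚP.*-identityʳ c) ⟨
    c * 1ℚ + c * ⌜ N ⌝                         ≡⟨ ℚP.*-distribˡ-+ c 1ℚ ⌜ N ⌝ ⟨
    c * (1ℚ + ⌜ N ⌝)                           ≡⟨ cong (c *_) (⌜⌝-+ 1 N) ⟨
    c * ⌜ suc N ⌝                              ∎
    where
    open ≡-Reasoning
    N : ℕ
    N = Σℕ (λ x → 𝟙 (b x)) xs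

  Σℚ-⌜⌝ : {A : Set} (h : A → ℕ) (c : ℚ) (xs : List A) → Σℚ (λ x → ⌜ h x ⌝ * c) xs ≡ ⌜ Σℕ h xs ⌝ * c
  Σℚ-⌜⌝ h c [] = sym (ℚP.*-zeroˡ c)
  Σℚ-⌜⌝ h c (x ∷ xs) = trans (cong (⌜ h x ⌝ * c +_) (Σℚ-⌜⌝ h c xs))
    (trans (sym (ℚP.*-distribʳ-+ c ⌜ h x ⌝ ⌜ Σℕ h xs ⌝)) (cong (_* c) (sym (⌜⌝-+ (h x) (Σℕ h xs)))))

  filter-map : {A B : Set} {P : Pred B 0ℓ} {Q : Pred A 0ℓ} (P? : Decidable P) (Q? : Decidable Q) (g : A → B) →
    (∀ x → does (P? (g x)) ≡ does (Q? x)) → ∀ xs → filter P? (map g xs) ≡ map g (filter Q? xs)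
  filter-map P? Q? g agree [] = refl
  filter-map P? Q? g agree (x ∷ xs) with does (P? (g x)) | does (Q? x) | agree x
  ... | true | true | refl = cong (g x ∷_) (filter-map P? Q? g agree xs)
  ... | false | false | refl = filter-map P? Q? g agree xs

  shift : ∀ {m} → Fin m × Fin m → Fin (suc m) × Fin (suc m)
  shift (i , j) = (suc i , suc j)

  row : ∀ m → Fin m → List (Fin m × Fin m)
  row m i = map (λ j → (i , j)) (filter (λ j → toℕ i <ℕ? toℕ j) (allFin m))

  row-suc : ∀ m (i : Fin (suc m)) → row (suc (suc m)) (suc i) ≡ map shift (row (suc m) i)
  row-suc m i = begin
    map (λ j → (suc i , j)) (filter (λ j → toℕ (suc i) <ℕ? toℕ j) (tabulate {n = suc m} suc))
      ≡⟨ cong (λ l → map (λ j → (suc i , j)) (filter (λ j → toℕ (suc i) <ℕ? toℕ j) l)) (sym (map-tabulate id suc)) ⟩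
    map (λ j → (suc i , j)) (filter (λ j → toℕ (suc i) <ℕ? toℕ j) (map suc (allFin (suc m))))
      ≡⟨ cong (map (λ j → (suc i , j))) (filter-map (λ j → toℕ (suc i) <ℕ? toℕ j) (λ j → toℕ i <ℕ? toℕ j) suc (λ _ → refl) (allFin (suc m))) ⟩
    map (λ j → (suc i , j)) (map suc (filter (λ j → toℕ i <ℕ? toℕ j) (allFin (suc m))))
      ≡⟨ trans (sym (map-∘ _)) (map-∘ _) ⟩
    map shift (row (suc m) i) ∎
    where open ≡-Reasoning

  row-zero : ∀ m → row (suc m) zero ≡ map (λ j → (zero , suc j)) (allFin m)
  row-zero m = begin
    map (λ j → (zero , j)) (filter (λ j → 0 <ℕ? toℕ j) (tabulate {n = m} suc))
      ≡⟨ cong (map (λ j → (zero , j))) (filter-all (λ j → 0 <ℕ? toℕ j) (tabulate⁺ (λ _ → ℕ.z<s))) ⟩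
    map (λ j → (zero , j)) (tabulate suc)     ≡⟨ map-tabulate suc (λ j → (zero , j)) ⟩
    tabulate (λ j → (zero , suc j))           ≡⟨ map-tabulate id (λ j → (zero , suc j)) ⟨
    map (λ j → (zero , suc j)) (allFin m)     ∎
    where open ≡-Reasoning

  pairs-suc : ∀ m → pairs (suc m) ≡ map (λ j → (zero , suc j)) (allFin m) ++ map shift (pairs m)
  pairs-suc zero = refl
  pairs-suc (suc m) = begin
    row (suc (suc m)) zero ++ concat (map (row (suc (suc m))) (tabulate {n = suc m} suc))
      ≡⟨ cong₂ _++_ (row-zero (suc m)) (cong concat (begin
           map (row (suc (suc m))) (tabulate suc)        ≡⟨ map-tabulate suc (row (suc (suc m))) ⟩
           tabulate (λ i → row (suc (suc m)) (suc i))    ≡⟨ tabulate-cong (row-suc m) ⟩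
           tabulate (λ i → map shift (row (suc m) i))     ≡⟨ map-tabulate (row (suc m)) (map shift) ⟨
           map (map shift) (tabulate (row (suc m)))      ≡⟨ cong (map (map shift)) (map-tabulate id (row (suc m))) ⟨
           map (map shift) (map (row (suc m)) (allFin (suc m))) ∎)) ⟩
    map (λ j → (zero , suc j)) (allFin (suc m)) ++ concat (map (map shift) (map (row (suc m)) (allFin (suc m))))
      ≡⟨ cong (map (λ j → (zero , suc j)) (allFin (suc m)) ++_) (concat-map (map (row (suc m)) (allFin (suc m)))) ⟩
    map (λ j → (zero , suc j)) (allFin (suc m)) ++ map shift (pairs (suc m)) ∎
    where open ≡-Reasoning

  Σℕ-pairs : ∀ m (g : Fin (suc m) × Fin (suc m) → ℕ) →
    Σℕ g (pairs (suc m)) ≡ Σℕ (λ j → g (zero , suc j)) (allFin m) ℕ.+ Σℕ (λ p → g (shift p)) (pairs m)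
  Σℕ-pairs m g = begin
    Σℕ g (pairs (suc m))
      ≡⟨ cong (Σℕ g) (pairs-suc m) ⟩
    Σℕ g (map (λ j → (zero , suc j)) (allFin m) ++ map shift (pairs m))
      ≡⟨ Σℕ-++ g (map (λ j → (zero , suc j)) (allFin m)) (map shift (pairs m)) ⟩
    Σℕ g (map (λ j → (zero , suc j)) (allFin m)) ℕ.+ Σℕ g (map shift (pairs m))
      ≡⟨ cong₂ ℕ._+_ (Σℕ-map g _ (allFin m)) (Σℕ-map g shift (pairs m)) ⟩
    Σℕ (λ j → g (zero , suc j)) (allFin m) ℕ.+ Σℕ (λ p → g (shift p)) (pairs m) ∎
    where open ≡-Reasoning

  Σℚ-pairs : ∀ m (g : Fin (suc m) × Fin (suc m) → ℚ) →
    Σℚ g (pairs (suc m)) ≡ Σℚ (λ j → g (zero , suc j)) (allFin m) + Σℚ (λ p → g (shift p)) (pairs m)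
  Σℚ-pairs m g = begin
    Σℚ g (pairs (suc m))
      ≡⟨ cong (Σℚ g) (pairs-suc m) ⟩
    Σℚ g (map (λ j → (zero , suc j)) (allFin m) ++ map shift (pairs m))
      ≡⟨ Σℚ-++ g (map (λ j → (zero , suc j)) (allFin m)) (map shift (pairs m)) ⟩
    Σℚ g (map (λ j → (zero , suc j)) (allFin m)) + Σℚ g (map shift (pairs m))
      ≡⟨ cong₂ _+_ (Σℚ-map g _ (allFin m)) (Σℚ-map g shift (pairs m)) ⟩
    Σℚ (λ j → g (zero , suc j)) (allFin m) + Σℚ (λ p → g (shift p)) (pairs m) ∎
    where open ≡-Reasoning

  -- The vertex with index k in Fin (suc m) (clamped to m; only used for k ≤ m).
  toFin : ∀ {m} → ℕ → Fin (suc m)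
  toFin {m} zero = zero
  toFin {zero} (suc k) = zero
  toFin {suc m} (suc k) = suc (toFin {m} k)

  toℕ-toFin : ∀ {m} k → k ≤ m → toℕ (toFin {m} k) ≡ k
  toℕ-toFin zero _ = refl
  toℕ-toFin {suc m} (suc k) (s≤s k≤m) = cong suc (toℕ-toFin {m} k k≤m)

  toFin-toℕ : ∀ {m} (x : Fin (suc m)) → toFin {m} (toℕ x) ≡ x
  toFin-toℕ zero = refl
  toFin-toℕ {suc m} (suc x) = cong suc (toFin-toℕ {m} x)

  Σ< : ℕ → (ℕ → ℕ) → ℕ
  Σ< zero g = 0
  Σ< (suc k) g = g 0 ℕ.+ Σ< k (λ i → g (suc i))

  Σℕ-allFin-Σ< : ∀ m (g : Fin (suc m) → ℕ) → Σℕ g (allFin (suc m)) ≡ Σ< (suc m) (λ k → g (toFin k))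
  Σℕ-allFin-Σ< zero g = refl
  Σℕ-allFin-Σ< (suc m) g = trans (Σℕ-allFin (suc m) g) (cong (g zero ℕ.+_) (Σℕ-allFin-Σ< m (λ j → g (suc j))))

  Σ<-consecutive≤Σℕ-pairs : ∀ m (g : Fin (suc m) × Fin (suc m) → ℕ) →
    Σ< m (λ i → g (toFin i , toFin (suc i))) ≤ Σℕ g (pairs (suc m))
  Σ<-consecutive≤Σℕ-pairs zero g = z≤n
  Σ<-consecutive≤Σℕ-pairs (suc m) g = begin
    g (zero , suc zero) ℕ.+ Σ< m (λ i → g (shift (toFin i , toFin (suc i))))
      ≤⟨ ℕP.+-mono-≤ first-in-row (Σ<-consecutive≤Σℕ-pairs m (λ p → g (shift p))) ⟩
    Σℕ (λ j → g (zero , suc j)) (allFin (suc m)) ℕ.+ Σℕ (λ p → g (shift p)) (pairs (suc m))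
      ≡⟨ Σℕ-pairs (suc m) g ⟨
    Σℕ g (pairs (suc (suc m))) ∎
    where
    open ℕP.≤-Reasoning
    first-in-row : g (zero , suc zero) ≤ Σℕ (λ j → g (zero , suc j)) (allFin (suc m))
    first-in-row = ℕP.≤-trans (ℕP.m≤m+n _ _) (ℕP.≤-reflexive (sym (Σℕ-allFin m (λ j → g (zero , suc j)))))

-- The total gap Σ_{i<j} (j - i) over the pairs of Fin (k+1) is C(k+2,3);
-- we use it in the form 3 · gapSum (k+1) = k · C(k+2,2).
module GapSum where
  open import Defs
  open import Data.Nat using (ℕ; zero; suc; _+_; _*_; _∸_)
  import Data.Nat.Properties as ℕP
  open import Data.Fin using (toℕ)
  open import Data.List using ([]; _∷_; allFin; length)
  open import Data.List.Properties using (length-tabulate)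
  open import Data.Product using (proj₁; proj₂)
  open import Relation.Binary.PropositionalEquality
  open import Data.Nat.Tactic.RingSolver using (solve-∀)
  open Sums

  gapSum : ℕ → ℕ
  gapSum k = Σℕ (λ p → toℕ (proj₂ p) ∸ toℕ (proj₁ p)) (pairs k)

  gaps-from-zero : ∀ k → Σℕ (λ j → suc (toℕ j)) (allFin k) ≡ choose2 (suc k)
  gaps-from-zero zero = refl
  gaps-from-zero (suc k) = trans (Σℕ-allFin k (λ j → suc (toℕ j)))
    (cong suc (trans (Σℕ-suc (λ j → suc (toℕ j)) (allFin k))
      (cong₂ _+_ (length-tabulate {n = k} (λ j → j)) (gaps-from-zero k))))
    where
    Σℕ-suc : ∀ {A : Set} (f : A → ℕ) xs → Σℕ (λ x → suc (f x)) xs ≡ length xs + Σℕ f xs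
    Σℕ-suc f [] = refl
    Σℕ-suc f (x ∷ xs) = trans (cong (suc (f x) +_) (Σℕ-suc f xs)) (cong suc (swap (f x) (length xs) (Σℕ f xs)))
      where
      swap : ∀ a b c → a + (b + c) ≡ b + (a + c)
      swap = solve-∀

  gapSum-suc : ∀ k → gapSum (suc k) ≡ choose2 (suc k) + gapSum k
  gapSum-suc k = trans (Σℕ-pairs k (λ p → toℕ (proj₂ p) ∸ toℕ (proj₁ p))) (cong (_+ gapSum k) (gaps-from-zero k))

  choose2-square : ∀ k → 2 * choose2 k + k ≡ k * k
  choose2-square zero = refl
  choose2-square (suc k) = begin
    2 * (k + choose2 k) + suc k          ≡⟨ regroup k (choose2 k) ⟩
    (2 * choose2 k + k) + (2 * k + 1)    ≡⟨ cong (_+ (2 * k + 1)) (choose2-square k) ⟩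
    k * k + (2 * k + 1)                  ≡⟨ square-suc k ⟩
    suc k * suc k                        ∎
    where
    open ≡-Reasoning
    regroup : ∀ k c → 2 * (k + c) + suc k ≡ (2 * c + k) + (2 * k + 1)
    regroup = solve-∀
    square-suc : ∀ k → k * k + (2 * k + 1) ≡ suc k * suc k
    square-suc = solve-∀

  gapSum-closed : ∀ k → 3 * gapSum (suc k) ≡ k * choose2 (suc (suc k))
  gapSum-closed zero = refl
  gapSum-closed (suc k) = ℕP.+-cancelʳ-≡ (suc (suc k)) _ _ (begin
    3 * gapSum (suc (suc k)) + suc (suc k)        ≡⟨ cong (λ z → 3 * z + suc (suc k)) (gapSum-suc (suc k)) ⟩
    3 * (c + gapSum (suc k)) + suc (suc k)        ≡⟨ regroup c (gapSum (suc k)) k ⟩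
    3 * gapSum (suc k) + (c + (2 * c + suc (suc k)))
      ≡⟨ cong₂ (λ a b → a + (c + b)) (gapSum-closed k) (choose2-square (suc (suc k))) ⟩
    k * c + (c + suc (suc k) * suc (suc k))       ≡⟨ expand k c ⟩
    suc k * (suc (suc k) + c) + suc (suc k)       ∎)
    where
    open ≡-Reasoning
    c : ℕ
    c = choose2 (suc (suc k))
    regroup : ∀ c s k → 3 * (c + s) + suc (suc k) ≡ 3 * s + (c + (2 * c + suc (suc k)))
    regroup = solve-∀
    expand : ∀ k c → k * c + (c + suc (suc k) * suc (suc k)) ≡ suc k * (suc (suc k) + c) + suc (suc k)
    expand = solve-∀

-- Lower bounds come from potentials (a function growing by at
-- most the edge weight along each edge) and from cuts (a vertex set closed
-- under e); upper bounds come from explicit walks.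
module Distances where
  open import Defs
  open import Data.Nat as ℕ using (ℕ; zero; suc)
  import Data.Nat.Properties as ℕP
  open import Data.Bool using (Bool; true; false; if_then_else_)
  open import Data.Fin using (Fin; toℕ)
  open import Data.Fin.Properties using (toℕ-injective)
  open import Data.List using (List; []; _∷_; map; allFin)
  open import Data.List.Relation.Unary.Any using (here; there)
  open import Data.List.Membership.Propositional using (_∈_)
  open import Data.List.Membership.Propositional.Properties using (∈-allFin)
  open import Data.Rational using (ℚ; 0ℚ; 1ℚ; _+_; _-_; -_; _≤_; _≤?_)
  open import Data.Rational.Properties
  open import Data.Product using (Σ; _×_; _,_)
  open import Data.Unit using (tt)
  open import Data.Empty using (⊥; ⊥-elim)
  open import Relation.Binary.PropositionalEquality
  open import Relation.Nullary using (yes; no; ¬_; does)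
  import Data.Rational.Solver as QS

  Edges : ℕ → Set
  Edges m = Fin m → Fin m → Bool

  Weights : ℕ → Set
  Weights m = Fin m → Fin m → ℚ

  lastStep : ∀ {m} → Edges m → Weights m → ℕ → Fin m → Fin m → Fin m → ℚ∞
  lastStep e wt k u v x = if e x v then dist≤ e wt k u x +∞ fin (wt x v) else ∞

  min∞-≥ : ∀ x y c → x ≥∞ c → y ≥∞ c → min∞ x y ≥∞ c
  min∞-≥ ∞ y c _ hy = hy
  min∞-≥ (fin p) ∞ c hx _ = hx
  min∞-≥ (fin p) (fin q) c hx hy with p ≤? q
  ... | yes _ = hx
  ... | no _ = hy

  minList∞-≥ : ∀ {A : Set} (f : A → ℚ∞) c (xs : List A) → (∀ x → f x ≥∞ c) → minList∞ (map f xs) ≥∞ c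
  minList∞-≥ f c [] h = tt
  minList∞-≥ f c (x ∷ xs) h = min∞-≥ (f x) _ c (h x) (minList∞-≥ f c xs h)

  dist-≥-potential : ∀ {m} (e : Edges m) (wt : Weights m) (φ : Fin m → ℚ) →
    (∀ x v → e x v ≡ true → φ v ≤ φ x + wt x v) →
    ∀ k u v → dist≤ e wt k u v ≥∞ (φ v - φ u)
  dist-≥-potential e wt φ pot zero u v with toℕ u ℕ.≟ toℕ v
  ... | yes u≡v rewrite toℕ-injective u≡v = ≤-reflexive (+-inverseʳ (φ v))
  ... | no _ = tt
  dist-≥-potential {m} e wt φ pot (suc k) u v =
    min∞-≥ _ _ _ (dist-≥-potential e wt φ pot k u v) (minList∞-≥ _ _ (allFin m) last)
    where
    last : ∀ x → lastStep e wt k u v x ≥∞ (φ v - φ u)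
    last x with e x v in exv
    ... | false = tt
    ... | true with dist≤ e wt k u x | dist-≥-potential e wt φ pot k u x
    ...   | ∞ | _ = tt
    ...   | fin d | φx-φu≤d = begin
      φ v - φ u             ≤⟨ +-monoˡ-≤ (- φ u) (pot x v exv) ⟩
      (φ x + wt x v) - φ u  ≡⟨ regroup (φ x) (wt x v) (φ u) ⟩
      (φ x - φ u) + wt x v  ≤⟨ +-monoˡ-≤ (wt x v) φx-φu≤d ⟩
      d + wt x v            ∎
      where
      open ≤-Reasoning
      open QS.+-*-Solver
      regroup : ∀ a b c → (a + b) - c ≡ (a - c) + b
      regroup = solve 3 (λ a b c → (a :+ b) :- c := (a :- c) :+ b) refl

  dist-nonneg : ∀ {m} (e : Edges m) (wt : Weights m) → (∀ x v → 0ℚ ≤ wt x v) → ∀ k u v → dist≤ e wt k u v ≥∞ 0ℚ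
  dist-nonneg e wt wt≥0 k u v =
    subst (dist≤ e wt k u v ≥∞_) (+-inverseʳ 0ℚ)
      (dist-≥-potential e wt (λ _ → 0ℚ) (λ x v _ → ≤-trans (wt≥0 x v) (≤-reflexive (sym (+-identityˡ _)))) k u v)

  dist-≥1 : ∀ {m} (e : Edges m) (wt : Weights m) → (∀ x v → 1ℚ ≤ wt x v) →
    ∀ k u v → ¬ u ≡ v → dist≤ e wt k u v ≥∞ 1ℚ
  dist-≥1 e wt wt≥1 k u v u≢v = subst (dist≤ e wt k u v ≥∞_) φv-φu≡1 (dist-≥-potential e wt φ pot k u v)
    where
    φ : _ → ℚ
    φ z = if does (z Data.Fin.≟ v) then 1ℚ else 0ℚ
    0≤φ : ∀ z → 0ℚ ≤ φ z
    0≤φ z with does (z Data.Fin.≟ v)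
    ... | true = <⇒≤ (positive⁻¹ 1ℚ)
    ... | false = ≤-refl
    φ≤1 : ∀ z → φ z ≤ 1ℚ
    φ≤1 z with does (z Data.Fin.≟ v)
    ... | true = ≤-refl
    ... | false = <⇒≤ (positive⁻¹ 1ℚ)
    pot : ∀ x z → _ → φ z ≤ φ x + wt x z
    pot x z _ = ≤-trans (φ≤1 z) (≤-trans (wt≥1 x z)
                  (≤-trans (≤-reflexive (sym (+-identityˡ _))) (+-monoˡ-≤ (wt x z) (0≤φ x))))
    φv-φu≡1 : φ v - φ u ≡ 1ℚ
    φv-φu≡1 with v Data.Fin.≟ v | u Data.Fin.≟ v
    ... | yes _ | no _ = refl
    ... | no v≢v | _ = ⊥-elim (v≢v refl)
    ... | yes _ | yes u≡v = ⊥-elim (u≢v u≡v)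

  dist-∞-cut : ∀ {m} (e : Edges m) (wt : Weights m) (C : Fin m → Bool) →
    (∀ x v → e x v ≡ true → C x ≡ true → C v ≡ true) →
    ∀ k u v → C u ≡ true → C v ≡ false → dist≤ e wt k u v ≡ ∞
  dist-∞-cut e wt C closed zero u v cu cv with toℕ u ℕ.≟ toℕ v
  ... | no _ = refl
  ... | yes u≡v rewrite toℕ-injective u≡v with trans (sym cu) cv
  ...   | ()
  dist-∞-cut {m} e wt C closed (suc k) u v cu cv rewrite dist-∞-cut e wt C closed k u v cu cv = all∞ (allFin m)
    where
    last∞ : ∀ x → lastStep e wt k u v x ≡ ∞
    last∞ x with e x v in exv
    ... | false = refl
    ... | true with C x in cx
    ...   | false rewrite dist-∞-cut e wt C closed k u x cu cx = refl
    ...   | true with trans (sym (closed x v exv cx)) cv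
    ...     | ()
    all∞ : ∀ xs → minList∞ (map (lastStep e wt k u v) xs) ≡ ∞
    all∞ [] = refl
    all∞ (x ∷ xs) rewrite last∞ x | all∞ xs = refl

  _≤∞_ : ℚ∞ → ℚ → Set
  fin a ≤∞ c = a ≤ c
  ∞ ≤∞ c = ⊥

  ≤∞-finite : ∀ {x c} → x ≤∞ c → Σ ℚ λ q → x ≡ fin q
  ≤∞-finite {fin a} _ = a , refl

  min∞-≤ˡ : ∀ x y c → x ≤∞ c → min∞ x y ≤∞ c
  min∞-≤ˡ (fin p) ∞ c h = h
  min∞-≤ˡ (fin p) (fin q) c h with p ≤? q
  ... | yes _ = h
  ... | no p≰q = ≤-trans (<⇒≤ (≰⇒> p≰q)) h

  min∞-≤ʳ : ∀ x y c → y ≤∞ c → min∞ x y ≤∞ c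
  min∞-≤ʳ ∞ (fin q) c h = h
  min∞-≤ʳ (fin p) (fin q) c h with p ≤? q
  ... | yes p≤q = ≤-trans p≤q h
  ... | no _ = h

  minList∞-≤ : ∀ {A : Set} (f : A → ℚ∞) c (xs : List A) x → x ∈ xs → f x ≤∞ c → minList∞ (map f xs) ≤∞ c
  minList∞-≤ f c (y ∷ xs) x (here refl) h = min∞-≤ˡ (f x) _ c h
  minList∞-≤ f c (y ∷ xs) x (there x∈xs) h = min∞-≤ʳ (f y) _ c (minList∞-≤ f c xs x x∈xs h)

  dist-weaken : ∀ {m} (e : Edges m) wt k l u v c → k ℕ.≤ l → dist≤ e wt k u v ≤∞ c → dist≤ e wt l u v ≤∞ c
  dist-weaken e wt k l u v c k≤l h rewrite sym (ℕP.m∸n+n≡m k≤l) = more (l ℕ.∸ k)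
    where
    more : ∀ j → dist≤ e wt (j ℕ.+ k) u v ≤∞ c
    more zero = h
    more (suc j) = min∞-≤ˡ (dist≤ e wt (j ℕ.+ k) u v) _ c (more j)

  data Walk {m} (e : Edges m) (u : Fin m) : Fin m → ℕ → Set where
    stay : Walk e u u 0
    step : ∀ {x v k} → Walk e u x k → e x v ≡ true → Walk e u v (suc k)

  walkWeight : ∀ {m} {e : Edges m} {u v k} → Weights m → Walk e u v k → ℚ
  walkWeight wt stay = 0ℚ
  walkWeight wt (step {x} {v} ω _) = walkWeight wt ω + wt x v

  walk⇒dist : ∀ {m} {e : Edges m} {u v k} (wt : Weights m) (ω : Walk e u v k) →
    dist≤ e wt k u v ≤∞ walkWeight wt ω
  walk⇒dist {u = u} wt stay with toℕ u ℕ.≟ toℕ u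
  ... | yes _ = ≤-refl
  ... | no u≢u = ⊥-elim (u≢u refl)
  walk⇒dist {m} {e} {u} {v} {suc k} wt (step {x} ω exv) =
    min∞-≤ʳ (dist≤ e wt k u v) _ _
      (minList∞-≤ (lastStep e wt k u v) _ (allFin m) x (∈-allFin x) (extend (dist≤ e wt k u x) (walk⇒dist wt ω)))
    where
    extend : ∀ d → d ≤∞ walkWeight wt ω → (if e x v then d +∞ fin (wt x v) else ∞) ≤∞ (walkWeight wt ω + wt x v)
    extend (fin a) a≤ rewrite exv = +-monoˡ-≤ (wt x v) a≤

  prepend : ∀ {m} {e : Edges m} {u x v k} → e u x ≡ true → Walk e x v k → Walk e u v (suc k)
  prepend eux stay = step stay eux
  prepend eux (step ω eyv) = step (prepend eux ω) eyv

  reverse : ∀ {m} {e : Edges m} {u v k} → (∀ i j → e i j ≡ e j i) → Walk e u v k → Walk e v u k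
  reverse e-sym stay = stay
  reverse e-sym (step {x} {v} ω exv) = prepend (trans (e-sym v x) exv) (reverse e-sym ω)

  walks⇒connected : ∀ {m} (e : Edges m) →
    (∀ u v → Σ ℕ λ k → k ℕ.≤ m × Walk e u v k) → Connected e
  walks⇒connected {m} e walks u v with walks u v
  ... | k , k≤m , ω = ≤∞-finite (dist-weaken e unit k m u v _ k≤m (walk⇒dist unit ω))
    where
    unit : Weights m
    unit _ _ = 1ℚ

module Distortion where
  open import Defs
  open import Data.Nat as ℕ using (ℕ; suc)
  open import Data.Integer using (+_)
  open import Data.Rational using (ℚ; 0ℚ; 1ℚ; _+_; _*_; _<_; _≤_; _/_; 1/_; NonZero; ≢-nonZero; positive; nonNegative)
  open import Data.Rational.Properties
  open import Data.List using (List; []; _∷_; map)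
  open import Data.List.Relation.Unary.Any using (here; there)
  open import Data.List.Membership.Propositional using (_∈_)
  open import Data.Product using (Σ; _,_; proj₁; proj₂)
  open import Data.Unit using (tt)
  open import Data.Empty using (⊥-elim)
  open import Relation.Binary using (tri<; tri≈; tri>)
  open import Relation.Binary.PropositionalEquality
  open import Relation.Nullary using (yes; no)
  open Distances using (_≤∞_)

  1/-nonneg : ∀ b .{{_ : NonZero b}} → 0ℚ < b → 0ℚ ≤ 1/ b
  1/-nonneg b 0<b = <⇒≤ (positive⁻¹ ((1/ b) {{pos⇒nonZero b {{positive 0<b}}}}) {{1/pos⇒pos b {{positive 0<b}}}})

  1/-antimono : ∀ b B .{{_ : NonZero b}} .{{_ : NonZero B}} → 0ℚ < b → b ≤ B → 1/ B ≤ 1/ b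
  1/-antimono b B 0<b b≤B = begin
    1/ B                ≡⟨ *-identityʳ (1/ B) ⟨
    1/ B * 1ℚ           ≡⟨ cong (1/ B *_) (*-inverseʳ b) ⟨
    1/ B * (b * 1/ b)   ≤⟨ *-monoˡ-≤-nonNeg (1/ B) {{nonNegative (1/-nonneg B 0<B)}}
                             (*-monoʳ-≤-nonNeg (1/ b) {{nonNegative (1/-nonneg b 0<b)}} b≤B) ⟩
    1/ B * (B * 1/ b)   ≡⟨ *-assoc (1/ B) B (1/ b) ⟨
    (1/ B * B) * 1/ b   ≡⟨ cong (_* 1/ b) (*-inverseˡ B) ⟩
    1ℚ * 1/ b           ≡⟨ *-identityˡ (1/ b) ⟩
    1/ b                ∎
    where
    open ≤-Reasoning
    0<B = <-≤-trans 0<b b≤B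

  ratio∞-nonneg : ∀ x y → x ≥∞ 0ℚ → y ≥∞ 0ℚ → ratio∞ x y ≥∞ 0ℚ
  ratio∞-nonneg ∞ y _ _ = tt
  ratio∞-nonneg (fin a) ∞ _ _ = ≤-refl
  ratio∞-nonneg (fin a) (fin b) 0≤a 0≤b with b ≟ 0ℚ
  ... | yes _ = ≤-refl
  ... | no b≢0 = nonNegative⁻¹ (a * 1/ b) {{nonNeg*nonNeg⇒nonNeg a {{nonNegative 0≤a}} (1/ b) {{nonNegative (1/-nonneg b 0<b)}}}}
    where
    instance _ = ≢-nonZero b≢0
    0<b : 0ℚ < b
    0<b with <-cmp 0ℚ b
    ... | tri< lt _ _ = lt
    ... | tri≈ _ eq _ = ⊥-elim (b≢0 (sym eq))
    ... | tri> _ _ gt = ⊥-elim (<-irrefl refl (<-≤-trans gt 0≤b))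

  ratio∞-≥ : ∀ x y t B .{{_ : NonZero B}} → 0ℚ ≤ t → x ≥∞ t → y ≥∞ 1ℚ → y ≤∞ B → ratio∞ x y ≥∞ (t * 1/ B)
  ratio∞-≥ ∞ y t B _ _ _ _ = tt
  ratio∞-≥ (fin a) (fin b) t B 0≤t t≤a 1≤b b≤B with b ≟ 0ℚ
  ... | yes b≡0 = ⊥-elim (<-irrefl refl (<-≤-trans (positive⁻¹ 1ℚ) (≤-trans 1≤b (≤-reflexive b≡0))))
  ... | no b≢0 = ≤-trans (*-monoˡ-≤-nonNeg t {{nonNegative 0≤t}} (1/-antimono b B 0<b b≤B))
                         (*-monoʳ-≤-nonNeg (1/ b) {{nonNegative (1/-nonneg b 0<b)}} t≤a)
    where
    instance _ = ≢-nonZero b≢0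
    0<b : 0ℚ < b
    0<b = <-≤-trans (positive⁻¹ 1ℚ) 1≤b

  sum∞-≥ : ∀ {A : Set} (f : A → ℚ∞) (g : A → ℚ) xs → (∀ x → f x ≥∞ g x) → sum∞ (map f xs) ≥∞ sumℚ (map g xs)
  sum∞-≥ f g [] h = ≤-refl
  sum∞-≥ f g (x ∷ xs) h with f x | h x | sum∞ (map f xs) | sum∞-≥ f g xs h
  ... | ∞ | _ | _ | _ = tt
  ... | fin a | _ | ∞ | _ = tt
  ... | fin a | ga≤a | fin s | gs≤s = +-mono-≤ ga≤a gs≤s

  +∞-finiteˡ : ∀ a b {s} → a +∞ b ≡ fin s → Σ ℚ λ c → a ≡ fin c
  +∞-finiteˡ (fin a) (fin b) _ = a , refl

  +∞-finiteʳ : ∀ a b {s} → a +∞ b ≡ fin s → Σ ℚ λ c → b ≡ fin c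
  +∞-finiteʳ (fin a) (fin b) _ = b , refl

  sum∞-finite : ∀ {A : Set} (f : A → ℚ∞) xs {s} x → sum∞ (map f xs) ≡ fin s → x ∈ xs → Σ ℚ λ c → f x ≡ fin c
  sum∞-finite f (y ∷ xs) x sum≡s (here refl) = +∞-finiteˡ (f y) _ sum≡s
  sum∞-finite f (y ∷ xs) x sum≡s (there x∈) = sum∞-finite f xs x (proj₂ (+∞-finiteʳ (f y) _ sum≡s)) x∈

  module _ {m : ℕ} {G : WGraph m} (H : Subgraph G) where

    ratios : List ℚ∞
    ratios = map (λ p → ratio∞ (dH H (proj₁ p) (proj₂ p)) (dG G (proj₁ p) (proj₂ p))) (pairs m)

    ratios-finite : ∀ {s} u v → sum∞ ratios ≡ fin s → (u , v) ∈ pairs m → Σ ℚ λ c → dH H u v ≡ fin c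
    ratios-finite u v sum≡s uv∈ with sum∞-finite (λ p → ratio∞ (dH H (proj₁ p) (proj₂ p)) (dG G (proj₁ p) (proj₂ p))) (pairs m) (u , v) sum≡s uv∈
    ... | c , ratio≡c = numerator-finite (dH H u v) (dG G u v) ratio≡c
      where
      numerator-finite : ∀ a b {c} → ratio∞ a b ≡ fin c → Σ ℚ λ d → a ≡ fin d
      numerator-finite (fin a) b _ = a , refl

    avgDistortion-≥ : ∀ c ρ K → choose2 m ≡ suc K →
      (∀ s → sum∞ ratios ≡ fin s → c ≤ ρ * (s * (+ 1 / suc K))) → avgDistortion H ≥∞ c ÷ ρ
    avgDistortion-≥ c ρ K pairs≡ bound with sum∞ ratios
    ... | ∞ = tt
    ... | fin s with choose2 m
    ...   | suc K' with pairs≡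
    ...     | refl = bound s refl

-- A Boolean p i says the path
-- edge i — i+1 is kept, q k says vertex k is marked.  The kept edges cut the
-- path into maximal segments; if every segment contains a marked vertex,
-- then (#segments = N + 1 - #kept edges) gives  N + 1 ≤ #kept + #marked.
module SegmentCounting where
  open import Data.Nat as ℕ using (ℕ; zero; suc; _≤_; _<_; z≤n; s≤s; _+_)
  open import Data.Nat.Properties
  open import Data.Bool using (Bool; true; false; _∨_)
  open import Data.Sum using (_⊎_; inj₁; inj₂)
  open import Data.Product using (Σ; _×_; _,_)
  open import Data.Empty using (⊥; ⊥-elim)
  open import Relation.Binary.PropositionalEquality
  open import Data.Nat.Tactic.RingSolver using (solve-∀)
  open Sums using (Σ<; 𝟙; 𝟙≤1)

  -- [a, …] cannot be extended to the left.  At a = 0 the flag `carried`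
  -- stands for an edge to a virtual vertex -1 (used in the induction).
  LeftEnd : ℕ → (ℕ → Bool) → Bool → Set
  LeftEnd zero p carried = carried ≡ false
  LeftEnd (suc a) p carried = p a ≡ false

  RightEnd : ℕ → ℕ → (ℕ → Bool) → Set
  RightEnd b N p = b ≡ N ⊎ p b ≡ false

  SegmentsMarked : ℕ → (ℕ → Bool) → (ℕ → Bool) → Bool → Set
  SegmentsMarked N p q carried = ∀ a b → a ≤ b → b ≤ N → LeftEnd a p carried → RightEnd b N p →
    (∀ k → a ≤ k → k ≤ b → q k ≡ false) → ⊥

  RightEnd-suc : ∀ {b N} p → RightEnd b N (λ i → p (suc i)) → RightEnd (suc b) (suc N) p
  RightEnd-suc p (inj₁ b≡N) = inj₁ (cong suc b≡N)
  RightEnd-suc p (inj₂ pb) = inj₂ pb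

  -- Dropping vertex 0 leaves the path 1 … N with all segments marked, as
  -- long as the new flag is false only when the segment starting at 1 was
  -- already maximal (edge 0 — 1 not kept), or extends the old first segment
  -- through an unmarked vertex 0.
  SegmentsMarked-tail : ∀ N p q carried carried' → SegmentsMarked (suc N) p q carried →
    (carried' ≡ false → LeftEnd 1 p carried ⊎ (carried ≡ false × q 0 ≡ false)) →
    SegmentsMarked N (λ i → p (suc i)) (λ i → q (suc i)) carried'
  SegmentsMarked-tail N p q carried carried' marked flag zero b a≤b b≤N start end unmarked with flag start
  ... | inj₁ p0 = marked 1 (suc b) (s≤s z≤n) (s≤s b≤N) p0 (RightEnd-suc p end)
                    (λ { (suc k) (s≤s _) (s≤s k≤b) → unmarked k z≤n k≤b })
  ... | inj₂ (carried≡false , q0) = marked 0 (suc b) z≤n (s≤s b≤N) carried≡false (RightEnd-suc p end) unmarked'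
    where
    unmarked' : ∀ k → 0 ≤ k → k ≤ suc b → q k ≡ false
    unmarked' zero _ _ = q0
    unmarked' (suc k) _ (s≤s k≤b) = unmarked k z≤n k≤b
  SegmentsMarked-tail N p q carried carried' marked flag (suc a) b a≤b b≤N start end unmarked =
    marked (suc (suc a)) (suc b) (s≤s a≤b) (s≤s b≤N) start (RightEnd-suc p end)
      (λ { (suc k) (s≤s a≤k) (s≤s k≤b) → unmarked k a≤k k≤b })

  𝟙-∨ : ∀ x y → 𝟙 (x ∨ y) ≤ 𝟙 y + 𝟙 x
  𝟙-∨ true true = s≤s z≤n
  𝟙-∨ true false = s≤s z≤n
  𝟙-∨ false true = s≤s z≤n
  𝟙-∨ false false = z≤n

  ∨-false : ∀ x y → x ∨ y ≡ false → x ≡ false × y ≡ false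
  ∨-false false false _ = refl , refl

  first-marked : ∀ N p q carried → RightEnd 0 N p → SegmentsMarked N p q carried → 1 ≤ 𝟙 (q 0) + 𝟙 carried
  first-marked N p q carried end marked with q 0 in q0 | carried
  ... | true | _ = s≤s z≤n
  ... | false | true = s≤s z≤n
  ... | false | false = ⊥-elim (marked 0 0 z≤n z≤n refl end (λ { zero _ _ → q0 }))

  -- If edge 0 — 1 is kept, vertex 0
  -- joins the next segment and hands its mark on through the flag; if not,
  -- its segment ends there and contributes a marked vertex of its own.
  segment-count : ∀ N p q carried → SegmentsMarked N p q carried →
    suc N ≤ Σ< N (λ i → 𝟙 (p i)) + Σ< (suc N) (λ i → 𝟙 (q i)) + 𝟙 carried
  segment-count zero p q carried marked =
    ≤-trans (first-marked zero p q carried (inj₁ refl) marked) (≤-reflexive (cong (_+ 𝟙 carried) (sym (+-identityʳ (𝟙 (q 0))))))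
  segment-count (suc N) p q carried marked with p 0 in p0
  ... | true = begin
    suc (suc N)                             ≤⟨ s≤s (segment-count N p' q' (carried ∨ q 0) (SegmentsMarked-tail N p q carried _ marked
                                                 (λ e → inj₂ (∨-false carried (q 0) e)))) ⟩
    suc (P' + Q' + 𝟙 (carried ∨ q 0))        ≤⟨ s≤s (+-monoʳ-≤ (P' + Q') (𝟙-∨ carried (q 0))) ⟩
    suc (P' + Q' + (𝟙 (q 0) + 𝟙 carried))    ≡⟨ regroup P' Q' (𝟙 (q 0)) (𝟙 carried) ⟩
    suc P' + (𝟙 (q 0) + Q') + 𝟙 carried      ∎
    where
    open ≤-Reasoning
    p' : ℕ → Bool
    p' i = p (suc i)
    q' : ℕ → Bool
    q' i = q (suc i)
    P' : ℕ
    P' = Σ< N (λ i → 𝟙 (p' i))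
    Q' : ℕ
    Q' = Σ< (suc N) (λ i → 𝟙 (q' i))
    regroup : ∀ a b c d → suc (a + b + (c + d)) ≡ suc a + (c + b) + d
    regroup = solve-∀
  ... | false = begin
    suc (suc N)                             ≡⟨ +-comm 1 (suc N) ⟩
    suc N + 1                               ≤⟨ +-mono-≤ (segment-count N p' q' false (SegmentsMarked-tail N p q carried false marked (λ _ → inj₁ p0)))
                                                        (first-marked (suc N) p q carried (inj₂ p0) marked) ⟩
    P' + Q' + 0 + (𝟙 (q 0) + 𝟙 carried)      ≡⟨ regroup P' Q' (𝟙 (q 0)) (𝟙 carried) ⟩
    P' + (𝟙 (q 0) + Q') + 𝟙 carried          ∎
    where
    open ≤-Reasoning
    p' : ℕ → Bool
    p' i = p (suc i)
    q' : ℕ → Bool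
    q' i = q (suc i)
    P' : ℕ
    P' = Σ< N (λ i → 𝟙 (p' i))
    Q' : ℕ
    Q' = Σ< (suc N) (λ i → 𝟙 (q' i))
    regroup : ∀ a b c d → a + b + 0 + (c + d) ≡ a + (c + b) + d
    regroup = solve-∀

  Σ<𝟙≤ : ∀ N (p : ℕ → Bool) → Σ< N (λ i → 𝟙 (p i)) ≤ N
  Σ<𝟙≤ zero p = z≤n
  Σ<𝟙≤ (suc N) p = +-mono-≤ (𝟙≤1 (p 0)) (Σ<𝟙≤ N (λ i → p (suc i)))

  Σ<𝟙-witness : ∀ M (q : ℕ → Bool) → 1 ≤ Σ< M (λ i → 𝟙 (q i)) → Σ ℕ λ k → k < M × q k ≡ true
  Σ<𝟙-witness (suc M) q pos with q 0 in q0
  ... | true = 0 , s≤s z≤n , q0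
  ... | false with Σ<𝟙-witness M (λ i → q (suc i)) pos
  ...   | k , k<M , qk = suc k , s≤s k<M , qk

  Σ<𝟙-pos : ∀ M (q : ℕ → Bool) k → k < M → q k ≡ true → 1 ≤ Σ< M (λ i → 𝟙 (q i))
  Σ<𝟙-pos (suc M) q zero _ qk rewrite qk = s≤s z≤n
  Σ<𝟙-pos (suc M) q (suc k) (s≤s k<M) qk = ≤-trans (Σ<𝟙-pos M (λ i → q (suc i)) k k<M qk) (m≤n+m _ (𝟙 (q 0)))

  Σ<𝟙-unique : ∀ M (q : ℕ → Bool) → Σ< M (λ i → 𝟙 (q i)) ≤ 1 → ∀ k k' → k < M → k' < M →
    q k ≡ true → q k' ≡ true → k ≡ k'
  Σ<𝟙-unique (suc M) q ≤1 zero zero _ _ _ _ = refl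
  Σ<𝟙-unique (suc M) q ≤1 zero (suc k') _ (s≤s k'<M) qk qk' rewrite qk =
    ⊥-elim (1+n≰n (≤-trans (s≤s (Σ<𝟙-pos M (λ i → q (suc i)) k' k'<M qk')) ≤1))
  Σ<𝟙-unique (suc M) q ≤1 (suc k) zero (s≤s k<M) _ qk qk' rewrite qk' =
    ⊥-elim (1+n≰n (≤-trans (s≤s (Σ<𝟙-pos M (λ i → q (suc i)) k k<M qk)) ≤1))
  Σ<𝟙-unique (suc M) q ≤1 (suc k) (suc k') (s≤s k<M) (s≤s k'<M) qk qk' =
    cong suc (Σ<𝟙-unique M (λ i → q (suc i)) (≤-trans (m≤n+m _ (𝟙 (q 0))) ≤1) k k' k<M k'<M qk qk')

  Σ<𝟙-exactly-one : ∀ M (q : ℕ → Bool) → 1 ≤ Σ< M (λ i → 𝟙 (q i)) → Σ< M (λ i → 𝟙 (q i)) ≤ 1 →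
    Σ ℕ λ k₀ → ∀ k → k < M → q k ≡ true → k ≡ k₀
  Σ<𝟙-exactly-one M q ≥1 ≤1 with Σ<𝟙-witness M q ≥1
  ... | k₀ , k₀<M , qk₀ = k₀ , λ k k<M qk → Σ<𝟙-unique M q ≤1 k k₀ k<M k₀<M qk qk₀

-- The two rational inequalities behind the theorem.  Throughout, ρ is the
-- lightness slack, n = M + 1 the number of path vertices, X = ρ n, and the
-- hub edges weigh A = 4X.
module Arithmetic where
  open import Data.Integer using (+_)
  open import Data.Rational using (ℚ; 0ℚ; 1ℚ; _+_; _*_; _-_; -_; _<_; _≤_; _/_; _<?_; nonNegative; positive)
  open import Data.Rational.Properties
  open import Relation.Binary.PropositionalEquality
  open import Relation.Nullary.Decidable using (toWitness)
  open import Data.Unit using (tt)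
  open import Data.Empty using (⊥)
  import Data.Rational.Solver as QS
  open QS.+-*-Solver

  X : ℚ → ℚ → ℚ
  X ρ M = ρ * (M + 1ℚ)

  hubWeight : ℚ → ℚ → ℚ
  hubWeight ρ M = X ρ M + X ρ M + X ρ M + X ρ M

  0≤-⇒≤ : ∀ {a b} → 0ℚ ≤ b - a → a ≤ b
  0≤-⇒≤ {a} {b} h = ≤-trans (≤-reflexive (sym (+-identityˡ a))) (≤-trans (+-monoˡ-≤ a h) (≤-reflexive (cancel b a)))
    where
    cancel : ∀ b a → (b - a) + a ≡ b
    cancel = solve 2 (λ b a → (b :- a) :+ a := b) refl

  ≤⇒0≤- : ∀ {a b} → a ≤ b → 0ℚ ≤ b - a
  ≤⇒0≤- {a} {b} h = ≤-trans (≤-reflexive (sym (+-inverseʳ a))) (+-monoˡ-≤ (- a) h)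

  0≤+ : ∀ {a b} → 0ℚ ≤ a → 0ℚ ≤ b → 0ℚ ≤ a + b
  0≤+ ha hb = ≤-trans (≤-reflexive (sym (+-identityʳ 0ℚ))) (+-mono-≤ ha hb)

  0≤* : ∀ {a b} → 0ℚ ≤ a → 0ℚ ≤ b → 0ℚ ≤ a * b
  0≤* {a} {b} ha hb = nonNegative⁻¹ (a * b) {{nonNeg*nonNeg⇒nonNeg a {{nonNegative ha}} b {{nonNegative hb}}}}

  ≤+nonneg : ∀ a b → 0ℚ ≤ b → a ≤ a + b
  ≤+nonneg a b 0≤b = ≤-trans (≤-reflexive (sym (+-identityʳ a))) (+-monoʳ-≤ a 0≤b)

  1≤hubWeight : ∀ ρ M → 1ℚ ≤ X ρ M → 1ℚ ≤ hubWeight ρ M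
  1≤hubWeight ρ M 1≤X = ≤-trans 1≤X (≤-trans (≤+nonneg x x 0≤X) (≤-trans (≤+nonneg (x + x) x 0≤X) (≤+nonneg (x + x + x) x 0≤X)))
    where
    x : ℚ
    x = X ρ M
    0≤X : 0ℚ ≤ x
    0≤X = ≤-trans (<⇒≤ (positive⁻¹ 1ℚ)) 1≤X

  -- A spanner with P path edges and Q ≥ 2 hub edges, where P + Q ≥ n, weighs
  -- at least A·Q + P ≥ 2A + M - 1, which exceeds (1+ρ)(A + M) because
  -- ρ(A + M) ≤ A/32 + A/4 and A ≥ 4.  Certificate: a nonnegative combination
  -- of the hypotheses equals -15/8.
  two-hub-edges-too-heavy : ∀ ρ M P Q →
    M + 1ℚ ≤ P + Q → 1ℚ + 1ℚ ≤ Q →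
    hubWeight ρ M * Q + P ≤ (1ℚ + ρ) * (hubWeight ρ M + M) →
    1ℚ ≤ X ρ M → ρ ≤ + 1 / 32 → 0ℚ ≤ ρ → ⊥
  two-hub-edges-too-heavy ρ M P Q h1 h2 h3 h4 h5 h6 = <-irrefl refl (≤-<-trans (≤-trans certificate≥0 (≤-reflexive certificate)) -15/8<0)
    where
    A : ℚ
    A = hubWeight ρ M
    0≤A-1 : 0ℚ ≤ A - 1ℚ
    0≤A-1 = ≤-trans (0≤+ (0≤* (<⇒≤ (positive⁻¹ (+ 4 / 1))) (≤⇒0≤- h4)) (<⇒≤ (positive⁻¹ (+ 3 / 1)))) (≤-reflexive (expand ρ M))
      where
      expand : ∀ ρ M → (+ 4 / 1) * (X ρ M - 1ℚ) + (+ 3 / 1) ≡ hubWeight ρ M - 1ℚ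
      expand = solve 2 (λ ρ M → con (+ 4 / 1) :* (ρ :* (M :+ con 1ℚ) :- con 1ℚ) :+ con (+ 3 / 1) :=
                            (ρ :* (M :+ con 1ℚ) :+ ρ :* (M :+ con 1ℚ) :+ ρ :* (M :+ con 1ℚ) :+ ρ :* (M :+ con 1ℚ)) :- con 1ℚ) refl
    0≤A : 0ℚ ≤ A
    0≤A = ≤-trans 0≤A-1 (≤-trans (+-monoʳ-≤ A (<⇒≤ (negative⁻¹ (- 1ℚ)))) (≤-reflexive (+-identityʳ A)))
    combination : ℚ
    combination = (((1ℚ + ρ) * (A + M) - (A * Q + P)) + ((P + Q) - (M + 1ℚ)) + (A - 1ℚ) * (Q - (1ℚ + 1ℚ))
                    + A * (+ 1 / 32 - ρ) + ρ) + (+ 23 / 8) * (X ρ M - 1ℚ)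
    certificate≥0 : 0ℚ ≤ combination
    certificate≥0 = 0≤+ (0≤+ (0≤+ (0≤+ (0≤+ (≤⇒0≤- h3) (≤⇒0≤- h1)) (0≤* 0≤A-1 (≤⇒0≤- h2))) (0≤* 0≤A (≤⇒0≤- h5))) h6)
                        (0≤* (<⇒≤ (positive⁻¹ (+ 23 / 8))) (≤⇒0≤- h4))
    certificate : combination ≡ - (+ 15 / 8)
    certificate = solve 4 (λ ρ M P Q →
       let X = ρ :* (M :+ con 1ℚ) ; A = X :+ X :+ X :+ X in
       (((con 1ℚ :+ ρ) :* (A :+ M) :- (A :* Q :+ P)) :+ ((P :+ Q) :- (M :+ con 1ℚ)) :+ (A :- con 1ℚ) :* (Q :- (con 1ℚ :+ con 1ℚ))
         :+ A :* (con (+ 1 / 32) :- ρ) :+ ρ) :+ con (+ 23 / 8) :* (X :- con 1ℚ) := con (- (+ 15 / 8))) refl ρ M P Q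
    -15/8<0 : - (+ 15 / 8) < 0ℚ
    -15/8<0 = toWitness {a? = - (+ 15 / 8) <? 0ℚ} tt

  -- The final estimate.  With total gap S, number of pairs C (3S = M·C),
  -- d_G ≤ B = 2A and ratio sum s ≥ S/B:
  --   ρ · s/C ≥ ρ S/(B C) = ρ M/(3B) = M/(24(M+1)) ≥ 1/32   as M ≥ 3.
  average-bound : ∀ ρ M S C s 1/B 1/C →
    S * 1/B ≤ s →
    1/B * ((0ℚ + hubWeight ρ M) + hubWeight ρ M) ≡ 1ℚ →
    1/C * C ≡ 1ℚ →
    (+ 3 / 1) * S ≡ M * C →
    + 3 / 1 ≤ M →
    0ℚ ≤ ρ → 0ℚ ≤ 1/C → 0ℚ < C → 0ℚ < (0ℚ + hubWeight ρ M) + hubWeight ρ M →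
    + 1 / 32 ≤ ρ * (s * 1/C)
  average-bound ρ M S C s 1/B 1/C S/B≤s inverseB inverseC 3S≡MC 3≤M 0≤ρ 0≤1/C 0<C 0<B =
    ≤-trans 1/32≤Y (*-monoˡ-≤-nonNeg ρ {{nonNegative 0≤ρ}} (*-monoʳ-≤-nonNeg 1/C {{nonNegative 0≤1/C}} S/B≤s))
    where
    B = (0ℚ + hubWeight ρ M) + hubWeight ρ M
    c : ℚ
    c = + 1 / 32
    K : ℚ
    K = B * C
    0<K : 0ℚ < K
    0<K = positive⁻¹ K {{pos*pos⇒pos B {{positive 0<B}} C {{positive 0<C}}}}
    Y : ℚ
    Y = ρ * ((S * 1/B) * 1/C)
    YK≡ρS : Y * K ≡ ρ * S
    YK≡ρS = trans (regroup ρ S 1/B 1/C B C) (trans (cong₂ (λ a b → (ρ * S) * (a * b)) inverseB inverseC)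
              (trans (cong ((ρ * S) *_) (*-identityˡ 1ℚ)) (*-identityʳ (ρ * S))))
      where
      regroup : ∀ ρ S 1/B 1/C B C → ρ * ((S * 1/B) * 1/C) * (B * C) ≡ (ρ * S) * ((1/B * B) * (1/C * C))
      regroup = solve 6 (λ ρ S 1/B 1/C B C → ρ :* ((S :* 1/B) :* 1/C) :* (B :* C) := (ρ :* S) :* ((1/B :* B) :* (1/C :* C))) refl
    3cK≡ : (+ 3 / 1) * (c * K) ≡ ((+ 3 / 4) * (M + 1ℚ)) * (ρ * C)
    3cK≡ = solve 3 (λ ρ M C → let X = ρ :* (M :+ con 1ℚ) ; A = X :+ X :+ X :+ X ; B = (con 0ℚ :+ A) :+ A in
              con (+ 3 / 1) :* (con (+ 1 / 32) :* (B :* C)) := (con (+ 3 / 4) :* (M :+ con 1ℚ)) :* (ρ :* C)) refl ρ M C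
    3ρS≡ : (+ 3 / 1) * (ρ * S) ≡ M * (ρ * C)
    3ρS≡ = trans (commute ρ S) (trans (cong (ρ *_) 3S≡MC) (rotate ρ M C))
      where
      commute : ∀ ρ S → (+ 3 / 1) * (ρ * S) ≡ ρ * ((+ 3 / 1) * S)
      commute = solve 2 (λ ρ S → con (+ 3 / 1) :* (ρ :* S) := ρ :* (con (+ 3 / 1) :* S)) refl
      rotate : ∀ ρ M C → ρ * (M * C) ≡ M * (ρ * C)
      rotate = solve 3 (λ ρ M C → ρ :* (M :* C) := M :* (ρ :* C)) refl
    3/4[M+1]≤M : (+ 3 / 4) * (M + 1ℚ) ≤ M
    3/4[M+1]≤M = 0≤-⇒≤ (≤-trans (0≤* (<⇒≤ (positive⁻¹ (+ 1 / 4))) (≤⇒0≤- 3≤M)) (≤-reflexive (expand M)))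
      where
      expand : ∀ M → (+ 1 / 4) * (M - (+ 3 / 1)) ≡ M - (+ 3 / 4) * (M + 1ℚ)
      expand = solve 1 (λ M → con (+ 1 / 4) :* (M :- con (+ 3 / 1)) := M :- con (+ 3 / 4) :* (M :+ con 1ℚ)) refl
    cK≤ρS : c * K ≤ ρ * S
    cK≤ρS = *-cancelˡ-≤-pos (+ 3 / 1) {{positive (positive⁻¹ (+ 3 / 1))}}
           (≤-trans (≤-reflexive 3cK≡) (≤-trans (*-monoʳ-≤-nonNeg (ρ * C) {{nonNegative (0≤* 0≤ρ (<⇒≤ 0<C))}} 3/4[M+1]≤M)
             (≤-reflexive (sym 3ρS≡))))
    1/32≤Y : c ≤ Y
    1/32≤Y = *-cancelʳ-≤-pos K {{positive 0<K}} (≤-trans cK≤ρS (≤-reflexive (sym YK≡ρS)))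

-- On the vertices 0 … n'+1, vertex 0 is a hub joined
-- to every path vertex 1 … n'+1 by an edge of weight A, and consecutive path
-- vertices are joined by edges of weight 1.  The path plus the hub edge to
-- vertex 1 is a spanning tree of weight A + n'.
module HubPath where
  open import Defs
  open import Data.Nat as ℕ using (ℕ; zero; suc; z≤n; s≤s; _≡ᵇ_; _∸_)
  import Data.Nat.Properties as ℕP
  open import Data.Bool using (Bool; true; false; if_then_else_; _∨_; T)
  open import Data.Bool.Properties using (∨-comm)
  open import Data.Sum using (_⊎_; inj₁; inj₂)
  open import Data.Unit using (tt)
  open import Data.Fin using (Fin; toℕ; zero; suc)
  open import Data.Fin.Properties using (toℕ<n)
  open import Data.List using (allFin)
  open import Data.Product using (Σ; _×_; _,_; proj₁; proj₂)
  open import Data.Rational using (ℚ; 0ℚ; 1ℚ; _+_; _*_; _<_; _≤_)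
  import Data.Rational.Properties as ℚP
  open import Data.List.Membership.Propositional using (_∈_)
  open import Data.List.Membership.Propositional.Properties using (∈-allFin; ∈-++⁺ˡ; ∈-map⁺)
  open import Relation.Binary.PropositionalEquality
  open import Relation.Nullary using (yes; no)
  open NatEmbedding
  open Sums
  open Distances
  open Arithmetic using (≤+nonneg)

  pathAdj : ℕ → ℕ → Bool
  pathAdj a b = (b ≡ᵇ suc a) ∨ (a ≡ᵇ suc b)

  graphAdj : ℕ → ℕ → Bool
  graphAdj zero zero = false
  graphAdj zero (suc _) = true
  graphAdj (suc _) zero = true
  graphAdj (suc a) (suc b) = pathAdj a b

  treeAdj : ℕ → ℕ → Bool
  treeAdj zero zero = false
  treeAdj zero (suc b) = b ≡ᵇ 0
  treeAdj (suc a) zero = a ≡ᵇ 0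
  treeAdj (suc a) (suc b) = pathAdj a b

  weight : ℚ → ℕ → ℕ → ℚ
  weight A zero _ = A
  weight A (suc _) zero = A
  weight A (suc _) (suc _) = 1ℚ

  pathAdj-sym : ∀ a b → pathAdj a b ≡ pathAdj b a
  pathAdj-sym a b = ∨-comm (b ≡ᵇ suc a) (a ≡ᵇ suc b)

  graphAdj-sym : ∀ a b → graphAdj a b ≡ graphAdj b a
  graphAdj-sym zero zero = refl
  graphAdj-sym zero (suc b) = refl
  graphAdj-sym (suc a) zero = refl
  graphAdj-sym (suc a) (suc b) = pathAdj-sym a b

  treeAdj-sym : ∀ a b → treeAdj a b ≡ treeAdj b a
  treeAdj-sym zero zero = refl
  treeAdj-sym zero (suc b) = refl
  treeAdj-sym (suc a) zero = refl
  treeAdj-sym (suc a) (suc b) = pathAdj-sym a b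

  weight-sym : ∀ A a b → weight A a b ≡ weight A b a
  weight-sym A zero zero = refl
  weight-sym A zero (suc b) = refl
  weight-sym A (suc a) zero = refl
  weight-sym A (suc a) (suc b) = refl

  ≡ᵇ-refl : ∀ a → (a ≡ᵇ a) ≡ true
  ≡ᵇ-refl zero = refl
  ≡ᵇ-refl (suc a) = ≡ᵇ-refl a

  ≡ᵇ-suc : ∀ a → (a ≡ᵇ suc a) ≡ false
  ≡ᵇ-suc zero = refl
  ≡ᵇ-suc (suc a) = ≡ᵇ-suc a

  graphAdj-irrefl : ∀ a → graphAdj a a ≡ false
  graphAdj-irrefl zero = refl
  graphAdj-irrefl (suc a) rewrite ≡ᵇ-suc a = refl

  pathAdj-cases : ∀ a b → pathAdj a b ≡ true → b ≡ suc a ⊎ a ≡ suc b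
  pathAdj-cases a b e with b ≡ᵇ suc a in b≡ᵇ1+a
  ... | true = inj₁ (ℕP.≡ᵇ⇒≡ b (suc a) (subst T (sym b≡ᵇ1+a) tt))
  ... | false = inj₂ (ℕP.≡ᵇ⇒≡ a (suc b) (subst T (sym e) tt))

  treeAdj⊆graphAdj : ∀ a b → treeAdj a b ≡ true → graphAdj a b ≡ true
  treeAdj⊆graphAdj zero (suc b) _ = refl
  treeAdj⊆graphAdj (suc a) zero _ = refl
  treeAdj⊆graphAdj (suc a) (suc b) e = e

  weight-≥ : ∀ {A} → 1ℚ ≤ A → ∀ a b → 1ℚ ≤ weight A a b
  weight-≥ 1≤A zero b = 1≤A
  weight-≥ 1≤A (suc a) zero = 1≤A
  weight-≥ 1≤A (suc a) (suc b) = ℚP.≤-refl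

  pathEdges : ∀ k → Σℕ (λ p → 𝟙 (pathAdj (toℕ (proj₁ p)) (toℕ (proj₂ p)))) (pairs (suc k)) ≡ k
  pathEdges zero = refl
  pathEdges (suc k) = trans (Σℕ-pairs (suc k) isPathEdge)
    (trans (cong (ℕ._+ Σℕ isPathEdge (pairs (suc k))) (trans (Σℕ-allFin k (λ j → 𝟙 (pathAdj 0 (suc (toℕ j))))) (cong suc (Σℕ-zero (allFin k)))))
           (cong suc (pathEdges k)))
    where
    isPathEdge : ∀ {l} → Fin l × Fin l → ℕ
    isPathEdge p = 𝟙 (pathAdj (toℕ (proj₁ p)) (toℕ (proj₂ p)))

  firstVertex : ∀ k → Σℕ (λ j → 𝟙 (toℕ j ≡ᵇ 0)) (allFin (suc k)) ≡ 1
  firstVertex k = trans (Σℕ-allFin k (λ j → 𝟙 (toℕ j ≡ᵇ 0))) (cong suc (Σℕ-zero (allFin k)))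

  module Construction (n' : ℕ) (A : ℚ) (1≤A : 1ℚ ≤ A) where
    m : ℕ
    m = suc (suc n')

    0<A : 0ℚ < A
    0<A = ℚP.<-≤-trans (ℚP.positive⁻¹ 1ℚ) 1≤A

    G : WGraph m
    G = record
      { adj = λ x y → graphAdj (toℕ x) (toℕ y)
      ; w = λ x y → weight A (toℕ x) (toℕ y)
      ; adj-sym = λ x y → graphAdj-sym (toℕ x) (toℕ y)
      ; w-sym = λ x y → weight-sym A (toℕ x) (toℕ y)
      ; irrefl = λ x → graphAdj-irrefl (toℕ x)
      ; w-pos = λ x y _ → ℚP.<-≤-trans (ℚP.positive⁻¹ 1ℚ) (weight-≥ 1≤A (toℕ x) (toℕ y))
      }

    T₀ : Subgraph G
    T₀ = record
      { sadj = λ x y → treeAdj (toℕ x) (toℕ y)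
      ; sadj-sym = λ x y → treeAdj-sym (toℕ x) (toℕ y)
      ; sadj-⊆ = λ x y → treeAdj⊆graphAdj (toℕ x) (toℕ y)
      }

    P : ℕ → Fin m
    P a = suc (toFin a)

    P-toℕ : (x : Fin (suc n')) → P (toℕ x) ≡ suc x
    P-toℕ x = cong suc (toFin-toℕ x)

    toℕ≤n' : (x : Fin (suc n')) → toℕ x ℕ.≤ n'
    toℕ≤n' x = ℕP.≤-pred (toℕ<n x)

    via-hub : ∀ x y → Walk (adj G) (suc x) (suc y) 2
    via-hub x y = step {x = zero} (step stay refl) refl

    G-connected : Connected (adj G)
    G-connected = walks⇒connected (adj G) walks
      where
      walks : ∀ u v → Σ ℕ λ k → k ℕ.≤ m × Walk (adj G) u v k
      walks zero zero = 0 , z≤n , stay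
      walks zero (suc y) = 1 , s≤s z≤n , step stay refl
      walks (suc x) zero = 1 , s≤s z≤n , step stay refl
      walks (suc x) (suc y) = 2 , s≤s (s≤s z≤n) , via-hub x y

    B : ℚ
    B = (0ℚ + A) + A

    0<B : 0ℚ < B
    0<B = ℚP.<-≤-trans 0<A (ℚP.≤-trans (ℚP.≤-reflexive (sym (ℚP.+-identityˡ A))) (≤+nonneg (0ℚ + A) A (ℚP.<⇒≤ 0<A)))

    dG-≤B : ∀ i j → dG G (suc i) (suc j) ≤∞ B
    dG-≤B i j = dist-weaken (adj G) (w G) 2 m (suc i) (suc j) B (s≤s (s≤s z≤n)) (walk⇒dist (w G) (via-hub i j))

    forward : ∀ {s k} a t → a ℕ.+ t ℕ.≤ n' → Walk (sadj T₀) s (P a) k → Walk (sadj T₀) s (P (a ℕ.+ t)) (t ℕ.+ k)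
    forward a zero _ ω rewrite ℕP.+-identityʳ a = ω
    forward a (suc t) a+t<n' ω rewrite ℕP.+-suc a t = step (forward a t a+t≤n' ω) path-edge
      where
      a+t≤n' : a ℕ.+ t ℕ.≤ n'
      a+t≤n' = ℕP.≤-trans (ℕP.n≤1+n _) a+t<n'
      path-edge : sadj T₀ (P (a ℕ.+ t)) (P (suc (a ℕ.+ t))) ≡ true
      path-edge rewrite toℕ-toFin {n'} (a ℕ.+ t) a+t≤n' | toℕ-toFin {n'} (suc (a ℕ.+ t)) a+t<n'
                      | ≡ᵇ-refl (a ℕ.+ t) = refl

    T₀-connected : Connected (sadj T₀)
    T₀-connected = walks⇒connected (sadj T₀) walks
      where
      T-sym : ∀ x y → sadj T₀ x y ≡ sadj T₀ y x
      T-sym x y = treeAdj-sym (toℕ x) (toℕ y)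
      ordered : ∀ a b → a ℕ.≤ b → b ℕ.≤ n' → Walk (sadj T₀) (P a) (P b) ((b ∸ a) ℕ.+ 0)
      ordered a b a≤b b≤n' = subst (λ z → Walk (sadj T₀) (P a) (P z) ((b ∸ a) ℕ.+ 0)) (ℕP.m+[n∸m]≡n a≤b)
        (forward a (b ∸ a) (ℕP.≤-trans (ℕP.≤-reflexive (ℕP.m+[n∸m]≡n a≤b)) b≤n') stay)
      along-path : ∀ a b → a ℕ.≤ n' → b ℕ.≤ n' → Σ ℕ λ k → k ℕ.≤ m × Walk (sadj T₀) (P a) (P b) k
      along-path a b a≤n' b≤n' with a ℕ.≤? b
      ... | yes a≤b = _ , ℕP.≤-trans (ℕP.≤-reflexive (ℕP.+-identityʳ _)) (ℕP.≤-trans (ℕP.m∸n≤m b a) (ℕP.m≤n⇒m≤o+n 2 b≤n')) ,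
                      ordered a b a≤b b≤n'
      ... | no a≰b = _ , ℕP.≤-trans (ℕP.≤-reflexive (ℕP.+-identityʳ _)) (ℕP.≤-trans (ℕP.m∸n≤m a b) (ℕP.m≤n⇒m≤o+n 2 a≤n')) ,
                     reverse T-sym (ordered b a (ℕP.<⇒≤ (ℕP.≰⇒> a≰b)) a≤n')
      from-hub : ∀ b → b ℕ.≤ n' → Walk (sadj T₀) zero (P b) (b ℕ.+ 1)
      from-hub b b≤n' = forward 0 b b≤n' (step stay refl)
      hub-length : ∀ b → b ℕ.≤ n' → b ℕ.+ 1 ℕ.≤ m
      hub-length b b≤n' = ℕP.≤-trans (ℕP.≤-reflexive (ℕP.+-comm b 1)) (s≤s (ℕP.m≤n⇒m≤1+n b≤n'))
      walks : ∀ u v → Σ ℕ λ k → k ℕ.≤ m × Walk (sadj T₀) u v k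
      walks zero zero = 0 , z≤n , stay
      walks zero (suc y) = _ , hub-length (toℕ y) (toℕ≤n' y) , subst (λ z → Walk (sadj T₀) zero z (toℕ y ℕ.+ 1)) (P-toℕ y) (from-hub (toℕ y) (toℕ≤n' y))
      walks (suc x) zero = _ , hub-length (toℕ x) (toℕ≤n' x) ,
        subst (λ z → Walk (sadj T₀) z zero (toℕ x ℕ.+ 1)) (P-toℕ x) (reverse T-sym (from-hub (toℕ x) (toℕ≤n' x)))
      walks (suc x) (suc y) with along-path (toℕ x) (toℕ y) (toℕ≤n' x) (toℕ≤n' y)
      ... | k , k≤m , ω = k , k≤m , subst₂ (λ u v → Walk (sadj T₀) u v k) (P-toℕ x) (P-toℕ y) ω

    T₀-spanning : IsSpanningTree T₀
    T₀-spanning = T₀-connected , edges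
      where
      edges : edgeCount (sadj T₀) ≡ suc n'
      edges = trans (length-filter (λ p → treeAdj (toℕ (proj₁ p)) (toℕ (proj₂ p))) (pairs m))
        (trans (Σℕ-pairs (suc n') (λ p → 𝟙 (treeAdj (toℕ (proj₁ p)) (toℕ (proj₂ p)))))
          (cong₂ ℕ._+_ (firstVertex n') (pathEdges n')))

    T₀-weight : wH T₀ ≡ A + ⌜ n' ⌝
    T₀-weight = begin
      wH T₀
        ≡⟨ Σℚ-pairs (suc n') (λ p → if treeAdj (toℕ (proj₁ p)) (toℕ (proj₂ p)) then weight A (toℕ (proj₁ p)) (toℕ (proj₂ p)) else 0ℚ) ⟩
      Σℚ (λ j → if toℕ j ≡ᵇ 0 then A else 0ℚ) (allFin (suc n'))
        + Σℚ (λ p → if pathAdj (toℕ (proj₁ p)) (toℕ (proj₂ p)) then 1ℚ else 0ℚ) (pairs (suc n'))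
        ≡⟨ cong₂ _+_ (Σℚ-if (λ j → toℕ j ≡ᵇ 0) A (allFin (suc n')))
                     (Σℚ-if (λ p → pathAdj (toℕ (proj₁ p)) (toℕ (proj₂ p))) 1ℚ (pairs (suc n'))) ⟩
      A * ⌜ Σℕ (λ j → 𝟙 (toℕ j ≡ᵇ 0)) (allFin (suc n')) ⌝
        + 1ℚ * ⌜ Σℕ (λ p → 𝟙 (pathAdj (toℕ (proj₁ p)) (toℕ (proj₂ p)))) (pairs (suc n')) ⌝
        ≡⟨ cong₂ (λ a b → A * ⌜ a ⌝ + 1ℚ * ⌜ b ⌝) (firstVertex n') (pathEdges n') ⟩
      A * 1ℚ + 1ℚ * ⌜ n' ⌝
        ≡⟨ cong₂ _+_ (ℚP.*-identityʳ A) (ℚP.*-identityˡ ⌜ n' ⌝) ⟩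
      A + ⌜ n' ⌝ ∎
      where open ≡-Reasoning

  hub-pair∈pairs : ∀ {n'} a → (zero , suc (toFin {n'} a)) ∈ pairs (suc (suc n'))
  hub-pair∈pairs {n'} a = subst ((zero , suc (toFin a)) ∈_) (sym (pairs-suc (suc n')))
    (∈-++⁺ˡ (∈-map⁺ (λ j → (zero , suc j)) (∈-allFin (toFin a))))

module SpannerOfHubPath where
  open import Defs
  open import Data.Nat as ℕ using (ℕ; zero; suc; s≤s; _∸_)
  import Data.Nat.Properties as ℕP
  open import Data.Bool using (Bool; true; false; if_then_else_; not)
  open import Data.Fin using (Fin; toℕ; zero; suc)
  open import Data.Fin.Properties using (suc-injective)
  open import Data.List using (allFin)
  open import Data.Product using (Σ; _×_; _,_; proj₁; proj₂)
  open import Data.Sum using (inj₁; inj₂)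
  open import Data.Empty using (⊥; ⊥-elim)
  open import Data.Rational using (ℚ; 0ℚ; 1ℚ; _+_; _*_; _≤_; 1/_; NonZero; positive)
  import Data.Rational.Properties as ℚP
  open import Relation.Binary.PropositionalEquality
  open import Relation.Nullary using (¬_; Dec; yes; no; does)
  open import Relation.Nullary.Decidable using (_×-dec_; dec-true; dec-false)
  open NatEmbedding
  open Sums
  open GapSum
  open Distances
  open Distortion
  open SegmentCounting
  open Arithmetic using (≤+nonneg)
  open HubPath

  module Spanner (n' : ℕ) (A : ℚ) (1≤A : 1ℚ ≤ A) (H : Subgraph (Construction.G n' A 1≤A)) where
    open Construction n' A 1≤A

    hubEdge : ℕ → Bool
    hubEdge k = sadj H zero (P k)

    pathEdge : ℕ → Bool
    pathEdge i = sadj H (P i) (P (suc i))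

    #hub : ℕ
    #hub = Σ< (suc n') (λ k → 𝟙 (hubEdge k))

    #path : ℕ
    #path = Σ< n' (λ i → 𝟙 (pathEdge i))

    hubEdge-toℕ : ∀ x → hubEdge (toℕ x) ≡ sadj H zero (suc x)
    hubEdge-toℕ x = cong (sadj H zero) (P-toℕ x)

    pathEdge-toℕ : ∀ x y → toℕ y ≡ suc (toℕ x) → pathEdge (toℕ x) ≡ sadj H (suc x) (suc y)
    pathEdge-toℕ x y y≡1+x = cong₂ (sadj H) (P-toℕ x) (trans (cong P (sym y≡1+x)) (P-toℕ y))

    wH-≥ : A * ⌜ #hub ⌝ + ⌜ #path ⌝ ≤ wH H
    wH-≥ = begin
      A * ⌜ #hub ⌝ + ⌜ #path ⌝
        ≤⟨ ℚP.+-monoʳ-≤ (A * ⌜ #hub ⌝) (⌜⌝-mono (Σ<-consecutive≤Σℕ-pairs n' kept)) ⟩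
      A * ⌜ #hub ⌝ + ⌜ Σℕ kept (pairs (suc n')) ⌝
        ≡⟨ cong₂ (λ a b → A * ⌜ a ⌝ + b) (Σℕ-allFin-Σ< n' (λ j → 𝟙 (sadj H zero (suc j)))) (ℚP.*-identityˡ _) ⟨
      A * ⌜ Σℕ (λ j → 𝟙 (sadj H zero (suc j))) (allFin (suc n')) ⌝ + 1ℚ * ⌜ Σℕ kept (pairs (suc n')) ⌝
        ≡⟨ cong₂ _+_ (Σℚ-if (λ j → sadj H zero (suc j)) A (allFin (suc n')))
                     (Σℚ-if (λ p → sadj H (suc (proj₁ p)) (suc (proj₂ p))) 1ℚ (pairs (suc n'))) ⟨
      Σℚ (λ j → if sadj H zero (suc j) then A else 0ℚ) (allFin (suc n'))
        + Σℚ (λ p → if sadj H (suc (proj₁ p)) (suc (proj₂ p)) then 1ℚ else 0ℚ) (pairs (suc n'))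
        ≡⟨ Σℚ-pairs (suc n') (λ p → if sadj H (proj₁ p) (proj₂ p) then w G (proj₁ p) (proj₂ p) else 0ℚ) ⟨
      wH H ∎
      where
      open ℚP.≤-Reasoning
      kept : Fin (suc n') × Fin (suc n') → ℕ
      kept p = 𝟙 (sadj H (suc (proj₁ p)) (suc (proj₂ p)))

    true≢false : true ≡ false → ⊥
    true≢false ()

    InSegment : ℕ → ℕ → Fin m → Set
    InSegment a b x = suc a ℕ.≤ toℕ x × toℕ x ℕ.≤ suc b

    InSegment? : ∀ a b x → Dec (InSegment a b x)
    InSegment? a b x = (suc a ℕ.≤? toℕ x) ×-dec (toℕ x ℕ.≤? suc b)

    segment-closed : ∀ a b → LeftEnd a pathEdge false → RightEnd b n' pathEdge →
      (∀ k → a ℕ.≤ k → k ℕ.≤ b → hubEdge k ≡ false) →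
      ∀ x v → sadj H x v ≡ true → InSegment a b x → InSegment a b v
    segment-closed a b start end unmarked zero v e (() , _)
    segment-closed a b start end unmarked (suc x) zero e (s≤s a≤x , s≤s x≤b) =
      ⊥-elim (true≢false (trans (sym e) (trans (sadj-sym H (suc x) zero)
        (trans (sym (hubEdge-toℕ x)) (unmarked (toℕ x) a≤x x≤b)))))
    segment-closed a b start end unmarked (suc x) (suc v) e (s≤s a≤x , s≤s x≤b)
      with pathAdj-cases (toℕ x) (toℕ v) (sadj-⊆ H (suc x) (suc v) e)
    ... | inj₁ v≡1+x with toℕ x ℕ.≟ b
    ...   | no x≢b = s≤s (ℕP.≤-trans a≤x (ℕP.≤-trans (ℕP.n≤1+n _) (ℕP.≤-reflexive (sym v≡1+x)))) ,
                     s≤s (ℕP.≤-trans (ℕP.≤-reflexive v≡1+x) (ℕP.≤∧≢⇒< x≤b x≢b))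
    ...   | yes x≡b with end
    ...     | inj₁ b≡n' = ⊥-elim (ℕP.1+n≰n (ℕP.≤-trans (ℕP.≤-reflexive (trans (cong suc (trans (sym b≡n') (sym x≡b))) (sym v≡1+x)))
                                                        (toℕ≤n' v)))
    ...     | inj₂ pb = ⊥-elim (true≢false (trans (sym e) (trans (sym (pathEdge-toℕ x v v≡1+x)) (trans (cong pathEdge x≡b) pb))))
    segment-closed a b start end unmarked (suc x) (suc v) e (s≤s a≤x , s≤s x≤b) | inj₂ x≡1+v with a ℕ.≤? toℕ v
    ... | yes a≤v = s≤s a≤v , s≤s (ℕP.≤-trans (ℕP.n≤1+n _) (ℕP.≤-trans (ℕP.≤-reflexive (sym x≡1+v)) x≤b))
    ... | no a≰v = ⊥-elim (true≢false (trans (sym e) (trans (sadj-sym H (suc x) (suc v))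
                    (trans (sym (pathEdge-toℕ v x x≡1+v)) (subst (λ z → LeftEnd z pathEdge false) a≡1+v start)))))
      where
      a≡1+v : a ≡ suc (toℕ v)
      a≡1+v = ℕP.≤-antisym (ℕP.≤-trans a≤x (ℕP.≤-reflexive x≡1+v)) (ℕP.≰⇒> a≰v)

    -- If every path vertex is reachable from the hub in H, then every
    -- maximal segment keeps a hub edge: otherwise the complement of the
    -- segment would be closed under H, cutting the hub off from it.
    segments-marked : (∀ a → a ℕ.≤ n' → Σ ℚ λ c → dH H zero (P a) ≡ fin c) → SegmentsMarked n' pathEdge hubEdge false
    segments-marked hub-finite a b a≤b b≤n' start end unmarked =
      ∞≢fin (trans (sym (dist-∞-cut (sadj H) (w G) outside closed m zero (P a) refl Pa-inside)) (proj₂ (hub-finite a a≤n')))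
      where
      a≤n' : a ℕ.≤ n'
      a≤n' = ℕP.≤-trans a≤b b≤n'
      outside : Fin m → Bool
      outside x = not (does (InSegment? a b x))
      closed : ∀ x v → sadj H x v ≡ true → outside x ≡ true → outside v ≡ true
      closed x v e x-out = cong not (dec-false (InSegment? a b v) v∉)
        where
        v∉ : ¬ InSegment a b v
        v∉ v∈ = true≢false (trans (sym x-out) (cong not (dec-true (InSegment? a b x)
                  (segment-closed a b start end unmarked v x (trans (sadj-sym H v x) e) v∈))))
      Pa-inside : outside (P a) ≡ false
      Pa-inside = cong not (dec-true (InSegment? a b (P a))
        (ℕP.≤-reflexive (cong suc (sym (toℕ-toFin a a≤n'))) , s≤s (ℕP.≤-trans (ℕP.≤-reflexive (toℕ-toFin a a≤n')) a≤b)))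
      ∞≢fin : ∀ {c} → ∞ ≡ fin c → ⊥
      ∞≢fin ()

    edge-count : (∀ a → a ℕ.≤ n' → Σ ℚ λ c → dH H zero (P a) ≡ fin c) → suc n' ℕ.≤ #path ℕ.+ #hub
    edge-count hub-finite = ℕP.≤-trans (segment-count n' pathEdge hubEdge false (segments-marked hub-finite))
                                       (ℕP.≤-reflexive (ℕP.+-identityʳ _))

    -- When the only hub edge of H goes to path vertex k0, the potential
    -- "index along the path" (with the hub at index k0) grows by at most the
    -- edge weight along every edge of H, so d_H(i, j) ≥ j - i on the path.
    module SingleHubEdge (k0 : ℕ) (unique : ∀ k → k ℕ.≤ n' → hubEdge k ≡ true → k ≡ k0) where

      index : Fin m → ℚ
      index zero = ⌜ k0 ⌝
      index (suc y) = ⌜ toℕ y ⌝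

      index-potential : ∀ x v → sadj H x v ≡ true → index v ≤ index x + w G x v
      index-potential zero zero e with sadj-⊆ H zero zero e
      ... | ()
      index-potential zero (suc y) e
        rewrite unique (toℕ y) (toℕ≤n' y) (trans (hubEdge-toℕ y) e) = ≤+nonneg _ A (ℚP.<⇒≤ 0<A)
      index-potential (suc y) zero e
        rewrite unique (toℕ y) (toℕ≤n' y) (trans (hubEdge-toℕ y) (trans (sadj-sym H zero (suc y)) e)) = ≤+nonneg _ A (ℚP.<⇒≤ 0<A)
      index-potential (suc y) (suc z) e with pathAdj-cases (toℕ y) (toℕ z) (sadj-⊆ H (suc y) (suc z) e)
      ... | inj₁ z≡1+y = ℚP.≤-reflexive (trans (cong ⌜_⌝ z≡1+y) (⌜⌝-suc (toℕ y)))
      ... | inj₂ y≡1+z = ℚP.≤-trans (⌜⌝-mono (ℕP.≤-trans (ℕP.n≤1+n (toℕ z)) (ℕP.≤-reflexive (sym y≡1+z))))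
                                    (≤+nonneg ⌜ toℕ y ⌝ 1ℚ (ℚP.<⇒≤ (ℚP.positive⁻¹ 1ℚ)))

      dH-≥-gap : ∀ i j → toℕ i ℕ.≤ toℕ j → dH H (suc i) (suc j) ≥∞ ⌜ toℕ j ∸ toℕ i ⌝
      dH-≥-gap i j i≤j = subst (dH H (suc i) (suc j) ≥∞_) (⌜⌝-∸ i≤j)
        (dist-≥-potential (sadj H) (w G) index index-potential m (suc i) (suc j))

      gap : Fin m × Fin m → ℕ
      gap (suc i , suc j) = toℕ j ∸ toℕ i
      gap (zero , _) = 0
      gap (suc i , zero) = 0

      instance
        B-nonZero : NonZero B
        B-nonZero = ℚP.pos⇒nonZero B {{positive 0<B}}

      ratio-≥0 : ∀ u v → ratio∞ (dH H u v) (dG G u v) ≥∞ (⌜ 0 ⌝ * 1/ B)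
      ratio-≥0 u v = subst (ratio∞ (dH H u v) (dG G u v) ≥∞_) (sym (ℚP.*-zeroˡ (1/ B)))
        (ratio∞-nonneg (dH H u v) (dG G u v) (dist-nonneg (sadj H) (w G) weights≥0 m u v) (dist-nonneg (adj G) (w G) weights≥0 m u v))
        where
        weights≥0 : ∀ x y → 0ℚ ≤ w G x y
        weights≥0 x y = ℚP.<⇒≤ (ℚP.<-≤-trans (ℚP.positive⁻¹ 1ℚ) (weight-≥ 1≤A (toℕ x) (toℕ y)))

      -- Every ratio is at least gap / B, since d_G ≤ B between path vertices.
      ratio-≥-gap : ∀ u v → ratio∞ (dH H u v) (dG G u v) ≥∞ (⌜ gap (u , v) ⌝ * 1/ B)
      ratio-≥-gap (suc i) (suc j) with toℕ i ℕ.<? toℕ j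
      ... | yes i<j = ratio∞-≥ (dH H (suc i) (suc j)) (dG G (suc i) (suc j)) ⌜ toℕ j ∸ toℕ i ⌝ B
            (⌜⌝-nonneg (toℕ j ∸ toℕ i)) (dH-≥-gap i j (ℕP.<⇒≤ i<j))
            (dist-≥1 (adj G) (w G) (λ x y → weight-≥ 1≤A (toℕ x) (toℕ y)) m (suc i) (suc j)
               (λ i≡j → ℕP.<-irrefl (cong toℕ (suc-injective i≡j)) i<j))
            (dG-≤B i j)
      ... | no i≮j rewrite ℕP.m≤n⇒m∸n≡0 (ℕP.≮⇒≥ i≮j) = ratio-≥0 (suc i) (suc j)
      ratio-≥-gap zero v = ratio-≥0 zero v
      ratio-≥-gap (suc i) zero = ratio-≥0 (suc i) zero

      ratios-≥ : sum∞ (ratios H) ≥∞ (⌜ gapSum (suc n') ⌝ * 1/ B)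
      ratios-≥ = subst (sum∞ (ratios H) ≥∞_) total
        (sum∞-≥ _ (λ p → ⌜ gap p ⌝ * 1/ B) (pairs m) (λ p → ratio-≥-gap (proj₁ p) (proj₂ p)))
        where
        total : Σℚ (λ p → ⌜ gap p ⌝ * 1/ B) (pairs m) ≡ ⌜ gapSum (suc n') ⌝ * 1/ B
        total = trans (Σℚ-⌜⌝ gap (1/ B) (pairs m)) (cong (λ z → ⌜ z ⌝ * 1/ B)
                  (trans (Σℕ-pairs (suc n') gap) (cong (ℕ._+ gapSum (suc n')) (Σℕ-zero (allFin (suc n'))))))

module LowerBound where
  open import Defs
  open import Data.Nat as ℕ using (ℕ; suc; s≤s)
  import Data.Nat.Properties as ℕP
  open import Data.Integer using (+_)
  open import Data.Rational using (ℚ; 0ℚ; 1ℚ; _+_; _*_; _<_; _≤_; _/_; 1/_; nonNegative)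
  import Data.Rational.Properties as ℚP
  open import Data.Bool using (true)
  open import Data.Fin using (zero)
  open import Data.Product using (Σ; _×_; _,_; proj₁; proj₂; map₂)
  open import Relation.Binary.PropositionalEquality
  open NatEmbedding
  open GapSum
  open Distortion
  open SegmentCounting
  open Arithmetic
  open HubPath
  open SpannerOfHubPath

  module Instance (n' : ℕ) (ρ : ℚ) (31≤n' : 31 ℕ.≤ n') (1≤ρn : 1ℚ ≤ ρ * ⌜ suc n' ⌝) (ρ≤1/32 : ρ ≤ + 1 / 32) where

    M : ℚ
    M = ⌜ n' ⌝

    1≤X : 1ℚ ≤ X ρ M
    1≤X = ℚP.≤-trans 1≤ρn (ℚP.≤-reflexive (cong (ρ *_) (⌜⌝-suc n')))

    0≤ρ : 0ℚ ≤ ρ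
    0≤ρ = ℚP.<⇒≤ (ℚP.*-cancelʳ-<-nonNeg ⌜ suc n' ⌝ {{nonNegative (⌜⌝-nonneg (suc n'))}}
            (ℚP.≤-<-trans (ℚP.≤-reflexive (ℚP.*-zeroˡ ⌜ suc n' ⌝)) (ℚP.<-≤-trans (ℚP.positive⁻¹ 1ℚ) 1≤ρn)))

    open Construction n' (hubWeight ρ M) (1≤hubWeight ρ M 1≤X) public

    -- Lightness at most 1 + ρ bounds the weight by (1 + ρ)(A + n'), comparing with the tree T₀.
    light⇒wH≤ : (H : Subgraph G) → Σ (Subgraph G) (λ T → IsMST T × wH H ≤ (1ℚ + ρ) * wH T) → wH H ≤ (1ℚ + ρ) * (hubWeight ρ M + M)
    light⇒wH≤ H (T , T-mst , light) = ℚP.≤-trans light (ℚP.*-monoˡ-≤-nonNeg (1ℚ + ρ) {{nonNegative 0≤1+ρ}}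
        (ℚP.≤-trans (proj₂ T-mst T₀ T₀-spanning) (ℚP.≤-reflexive T₀-weight)))
      where
      0≤1+ρ : 0ℚ ≤ 1ℚ + ρ
      0≤1+ρ = 0≤+ (ℚP.<⇒≤ (ℚP.positive⁻¹ 1ℚ)) 0≤ρ

    module _ (H : Subgraph G) (wH≤ : wH H ≤ (1ℚ + ρ) * (hubWeight ρ M + M)) where
      open Spanner n' (hubWeight ρ M) (1≤hubWeight ρ M 1≤X) H

      -- If the hub reaches every path vertex, H keeps exactly one hub edge:
      -- at least one by the segment count, at most one by its weight.
      single-hub-edge : (∀ a → a ℕ.≤ n' → Σ ℚ λ c → dH H zero (P a) ≡ fin c) →
        Σ ℕ λ k₀ → ∀ k → k ℕ.≤ n' → hubEdge k ≡ true → k ≡ k₀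
      single-hub-edge hub-finite =
        map₂ (λ unique k k≤n' → unique k (s≤s k≤n')) (Σ<𝟙-exactly-one (suc n') hubEdge at-least-one at-most-one)
        where
        count : suc n' ℕ.≤ #path ℕ.+ #hub
        count = edge-count hub-finite
        at-least-one : 1 ℕ.≤ #hub
        at-least-one = ℕP.+-cancelˡ-≤ n' 1 #hub (begin
          n' ℕ.+ 1          ≡⟨ ℕP.+-comm n' 1 ⟩
          suc n'            ≤⟨ count ⟩
          #path ℕ.+ #hub    ≤⟨ ℕP.+-monoˡ-≤ #hub (Σ<𝟙≤ n' pathEdge) ⟩
          n' ℕ.+ #hub       ∎)
          where open ℕP.≤-Reasoning
        at-most-one : #hub ℕ.≤ 1
        at-most-one = ℕP.≮⇒≥ λ 1<#hub →
          two-hub-edges-too-heavy ρ M ⌜ #path ⌝ ⌜ #hub ⌝ n≤P+Q (2≤Q 1<#hub) (ℚP.≤-trans wH-≥ wH≤) 1≤X ρ≤1/32 0≤ρ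
          where
          n≤P+Q : M + 1ℚ ≤ ⌜ #path ⌝ + ⌜ #hub ⌝
          n≤P+Q = ℚP.≤-trans (ℚP.≤-reflexive (sym (⌜⌝-suc n'))) (ℚP.≤-trans (⌜⌝-mono count) (ℚP.≤-reflexive (⌜⌝-+ #path #hub)))
          2≤Q : 1 ℕ.< #hub → 1ℚ + 1ℚ ≤ ⌜ #hub ⌝
          2≤Q 1<#hub = ℚP.≤-trans (ℚP.≤-reflexive (sym (⌜⌝-+ 1 1))) (⌜⌝-mono 1<#hub)

      distortion-bound : avgDistortion H ≥∞ (+ 1 / 32) ÷ ρ
      distortion-bound = avgDistortion-≥ H (+ 1 / 32) ρ K refl bound
        where
        K : ℕ
        K = n' ℕ.+ choose2 (suc n')
        bound : ∀ s → sum∞ (ratios H) ≡ fin s → + 1 / 32 ≤ ρ * (s * (+ 1 / suc K))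
        bound s sum≡s =
          average-bound ρ M ⌜ gapSum (suc n') ⌝ ⌜ suc K ⌝ s (1/ B) (+ 1 / suc K)
            (subst (_≥∞ (⌜ gapSum (suc n') ⌝ * 1/ B)) sum≡s ratios-≥) (ℚP.*-inverseˡ B) (⌜⌝-inverse K)
            3S≡MC (⌜⌝-mono (ℕP.≤-trans (s≤s (s≤s (s≤s ℕ.z≤n))) 31≤n')) 0≤ρ
            (ℚP.nonNegative⁻¹ (+ 1 / suc K) {{ℚP.normalize-nonNeg 1 (suc K)}}) (⌜⌝-pos K) 0<B
          where
          single : Σ ℕ λ k₀ → ∀ k → k ℕ.≤ n' → hubEdge k ≡ true → k ≡ k₀
          single = single-hub-edge (λ a _ → ratios-finite H zero (P a) sum≡s (hub-pair∈pairs a))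
          open SingleHubEdge (proj₁ single) (proj₂ single)
          3S≡MC : (+ 3 / 1) * ⌜ gapSum (suc n') ⌝ ≡ M * ⌜ suc K ⌝
          3S≡MC = trans (sym (⌜⌝-* 3 (gapSum (suc n')))) (trans (cong ⌜_⌝ (gapSum-closed n')) (⌜⌝-* n' (suc K)))

open import Defs
open import Data.Nat using (ℕ; suc; _≥_; s≤s)
open import Data.Integer using (+_)
open import Data.Rational using (ℚ; 0ℚ; 1ℚ; _+_; _*_; _<_; _≤_; _/_)
open import Data.Rational.Properties using (positive⁻¹)
open import Data.Product using (Σ; _×_; _,_)

mainTheorem9 : Σ ℚ λ c → 0ℚ < c ×
    ((n : ℕ) → n ≥ 32 → (ρ : ℚ) → 1ℚ ≤ ρ * (+ n / 1) → ρ ≤ + 1 / 32 →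
      Σ (WGraph (suc n)) λ G → Connected (adj G) ×
        ((H : Subgraph G) →
          Σ (Subgraph G) (λ T → IsMST T × wH H ≤ (1ℚ + ρ) * wH T) →
          avgDistortion H ≥∞ c ÷ ρ))
mainTheorem9 = + 1 / 32 , positive⁻¹ (+ 1 / 32) , lower-bound
  where
  lower-bound : (n : ℕ) → n ≥ 32 → (ρ : ℚ) → 1ℚ ≤ ρ * (+ n / 1) → ρ ≤ + 1 / 32 →
    Σ (WGraph (suc n)) λ G → Connected (adj G) ×
      ((H : Subgraph G) → Σ (Subgraph G) (λ T → IsMST T × wH H ≤ (1ℚ + ρ) * wH T) →
        avgDistortion H ≥∞ (+ 1 / 32) ÷ ρ)
  lower-bound (suc n') (s≤s 31≤n') ρ 1≤ρn ρ≤1/32 =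
    G , G-connected , λ H light → distortion-bound H (light⇒wH≤ H light)
    where open LowerBound.Instance n' ρ 31≤n' 1≤ρn ρ≤1/32
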